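{- Let $k\ge2$ be even and let $p$ be a distribution on $[k]\times[k]$ with marginals $p_1,p_2$ such that $d_{TV}(p,p_1\otimes p_2)\ge\gamma>0$. Let $S_1,S_2$ be independent random subsets of $[k]$, each uniformly distributed over all subsets of cardinality $k/2$. Then there exist positive constants $c$ and $\rho$ such that $$\Pr\Big[\big|p(S_1\times S_2)-p_1(S_1)p_2(S_2)\big|\ge c\,\frac{d_{TV}(p,p_1\otimes p_2)}{k}\Big]\ge\rho .$$
   Context: $d_{TV}$ is total variation distance; $(p_1\otimes p_2)(x_1,x_2)=p_1(x_1)p_2(x_2)$; $p(A)=\sum_{a\in A}p(a)$.
   Formalization: The distribution p takes rational values, and the parameter γ is rational. -}

module Defs where

open import Data.Nat using (ℕ; zero; suc)
open import Data.Fin using (Fin; zero; suc)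
open import Data.Bool using (Bool; true; false)
open import Data.Vec using (Vec; _∷_; []; lookup)
open import Data.List using (List; []; _∷_; _++_; map; filter; length; cartesianProduct)
open import Data.Product using (_×_; _,_)
open import Data.Rational using (ℚ; 0ℚ; 1ℚ; ½; _+_; _-_; _*_; _≤_; ∣_∣)
open import Data.Rational.Properties using (_≤?_)
open import Data.Fin.Subset using (Subset; inside; outside) renaming (∣_∣ to size)
open import Relation.Binary.PropositionalEquality using (_≡_)
open import Data.Integer using (+_)
open import Data.Rational using (_/_)
open import Level using (0ℓ)
open import Relation.Unary using (Pred; Decidable)

ℕtoℚ : ℕ → ℚ
ℕtoℚ n = + n / 1

sumFin : {n : ℕ} → (Fin n → ℚ) → ℚ
sumFin {zero}  f = 0ℚ
sumFin {suc n} f = f zero + sumFin (λ i → f (suc i))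

record IsDist2 (k : ℕ) (p : Fin k → Fin k → ℚ) : Set where
  field
    nonneg : ∀ i j → 0ℚ ≤ p i j
    total  : sumFin (λ i → sumFin (λ j → p i j)) ≡ 1ℚ

marg₁ : {k : ℕ} → (Fin k → Fin k → ℚ) → Fin k → ℚ
marg₁ p i = sumFin (λ j → p i j)

marg₂ : {k : ℕ} → (Fin k → Fin k → ℚ) → Fin k → ℚ
marg₂ p j = sumFin (λ i → p i j)

_⊗_ : {k : ℕ} → (Fin k → ℚ) → (Fin k → ℚ) → Fin k → Fin k → ℚ
(p₁ ⊗ p₂) i j = p₁ i * p₂ j

dTV : {k : ℕ} → (Fin k → Fin k → ℚ) → (Fin k → Fin k → ℚ) → ℚ
dTV p q = ½ * sumFin (λ i → sumFin (λ j → ∣ p i j - q i j ∣))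

𝟙 : {k : ℕ} → Subset k → Fin k → ℚ
𝟙 S i with lookup S i
... | true  = 1ℚ
... | false = 0ℚ

mass : {k : ℕ} → (Fin k → ℚ) → Subset k → ℚ
mass q S = sumFin (λ i → 𝟙 S i * q i)

mass₂ : {k : ℕ} → (Fin k → Fin k → ℚ) → Subset k → Subset k → ℚ
mass₂ p S₁ S₂ = sumFin (λ i → sumFin (λ j → 𝟙 S₁ i * 𝟙 S₂ j * p i j))

allSubsets : (n : ℕ) → List (Subset n)
allSubsets zero    = [] ∷ []
allSubsets (suc n) = map (inside ∷_) (allSubsets n) ++ map (outside ∷_) (allSubsets n)

subsetsOfSize : (n m : ℕ) → List (Subset n)
subsetsOfSize n m = filter (λ S → size S Data.Nat.≟ m) (allSubsets n)

-- Pr[E] for (S₁,S₂) independent, each uniform over subsets of [n] of size m: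
-- number of pairs satisfying E divided by the total number of pairs.
-- We express "Pr[E] ≥ ρ" as  ρ · #pairs ≤ #good pairs  to avoid division.
pairs : (n m : ℕ) → List (Subset n × Subset n)
pairs n m = cartesianProduct (subsetsOfSize n m) (subsetsOfSize n m)

goodCount : (n m : ℕ) {E : Pred (Subset n × Subset n) 0ℓ} → Decidable E → ℕ
goodCount n m E? = length (filter E? (pairs n m))

ProbAtLeast : (n m : ℕ) {E : Pred (Subset n × Subset n) 0ℓ} → Decidable E → ℚ → Set
ProbAtLeast n m {E} E? ρ = ρ * ℕtoℚ (length (pairs n m)) ≤ ℕtoℚ (goodCount n m E?)

-- the event |p(S₁×S₂) − p₁(S₁)p₂(S₂)| ≥ c · d_TV(p, p₁⊗p₂) / k, written as
-- c · d_TV ≤ k · |p(S₁×S₂) − p₁(S₁)p₂(S₂)|  (k > 0)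
Event : {k : ℕ} → (Fin k → Fin k → ℚ) → ℚ → Subset k × Subset k → Set
Event {k} p c (S₁ , S₂) =
  c * dTV p (marg₁ p ⊗ marg₂ p)
    ≤ ℕtoℚ k * ∣ mass₂ p S₁ S₂ - mass (marg₁ p) S₁ * mass (marg₂ p) S₂ ∣

Event? : {k : ℕ} (p : Fin k → Fin k → ℚ) (c : ℚ) → Decidable (Event p c)
Event? p c (S₁ , S₂) = _ ≤? _

-- Write D = p − p₁ ⊗ p₂. Its rows and columns sum to zero, and
-- p(S₁ × S₂) − p₁(S₁) p₂(S₂) = Y(S₁, S₂) := ∑_{i ∈ S₁, j ∈ S₂} D i j.
-- For a vector u with ∑ u = 0 the moments of u(S) = ∑_{i ∈ S} u_i over the m-subsets S of
-- an n-set are explicit in the power sums of u: ∑_S u(S)² = C(n−2, m−1) ‖u‖² and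
-- ∑_S u(S)⁴ ≤ 13 C(n, m) ‖u‖⁴. Applying this in S₁ and then in S₂, with n = 2m and
-- C(2m−2, m−1) ≥ C(2m, m)/4, the mean of Y² is at least Φ/16 and the mean of Y⁴ at most
-- 169 Φ², where Φ = ∑ D². By Paley–Zygmund, Y² exceeds Φ/64 with probability at least
-- (3/64)²/169, and since (2 d_TV)² = (∑ |D|)² ≤ n² Φ by Cauchy–Schwarz, n |Y| ≥ d_TV/4 there.

module Submission where

open import Agda.Builtin.FromNat using (Number; fromNat)
open import Algebra.Bundles using (CommutativeMonoid)
open import Data.Bool using (true; false)
open import Data.Fin using (Fin; zero; suc)
open import Data.Fin.Subset using (Subset; inside; outside) renaming (∣_∣ to size)
open import Data.List using (List; []; _∷_; _++_; map; filter; length; cartesianProduct)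
open import Data.List.Properties using (filter-++; filter-none)
import Data.List.Relation.Unary.All as All
import Data.List.Relation.Unary.All.Properties as All
import Data.Integer as ℤ
import Data.Integer.Properties as ℤ
open import Data.Nat using (ℕ; zero; suc; _*_; z≤n; s≤s) renaming (_≤_ to _≤ℕ_)
open import Data.Nat.Coprimality using (1-coprimeTo) renaming (sym to coprime-sym)
import Data.Nat as ℕ
import Data.Nat.Literals as ℕ
import Data.Nat.Properties as ℕ
open import Data.Product using (Σ; _×_; _,_)
open import Data.Rational
  using (ℚ; 0ℚ; 1ℚ; ½; mkℚ; _/_; _<_; _≤_; _+_; _-_; -_; ∣_∣; nonNegative; nonPositive; positive)
  renaming (_*_ to _·_)
import Data.Rational.Literals as ℚ
open import Data.Rational.Properties
open import Algebra.Properties.CommutativeSemigroup (CommutativeMonoid.commutativeSemigroup +-0-commutativeMonoid)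
  using () renaming (interchange to +-interchange)
open import Data.Sum using (_⊎_; inj₁; inj₂)
open import Data.Unit using (⊤; tt)
open import Data.Vec using (_∷_; lookup)
open import Data.Vec.Functional using (tail)
open import Level using (0ℓ)
open import Relation.Binary.PropositionalEquality
open import Relation.Nullary using (¬_; does; yes; no; contradiction)
open import Relation.Unary using (Pred; Decidable)
open import Relation.Nullary.Decidable using (dec⇒maybe)
open import Tactic.RingSolver using (solve-∀)
import Tactic.RingSolver.Core.AlmostCommutativeRing as ACR

open import Defs

-- Numerals in ℚ and ℕ; the literal constraint is ⊤, which instance search must inhabit.
instance
  ℚ-number : Number ℚ
  ℚ-number = ℚ.number

  ℕ-number : Number ℕ
  ℕ-number = ℕ.number

  ⊤-instance : ⊤
  ⊤-instance = tt

ℚ-ring : ACR.AlmostCommutativeRing 0ℓ 0ℓ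
ℚ-ring = ACR.fromCommutativeRing +-*-commutativeRing (λ x → dec⇒maybe (0ℚ ≟ x))

-- solve-∀ only recognises exponentiation in the form of the ring's own _^_.
open ACR.AlmostCommutativeRing ℚ-ring using (_^_)

-- Rational arithmetic

·-monoˡ-≤ : ∀ {r p q} → 0ℚ ≤ r → p ≤ q → r · p ≤ r · q
·-monoˡ-≤ {r} 0≤r = *-monoˡ-≤-nonNeg r {{nonNegative 0≤r}}

·-monoʳ-≤ : ∀ {r p q} → 0ℚ ≤ r → p ≤ q → p · r ≤ q · r
·-monoʳ-≤ {r} 0≤r = *-monoʳ-≤-nonNeg r {{nonNegative 0≤r}}

·-cancelˡ-≤ : ∀ {r p q} → 0ℚ < r → r · p ≤ r · q → p ≤ q
·-cancelˡ-≤ {r} 0<r = *-cancelˡ-≤-pos r {{positive 0<r}}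

·-nonNeg : ∀ {p q} → 0ℚ ≤ p → 0ℚ ≤ q → 0ℚ ≤ p · q
·-nonNeg {p} {q} 0≤p 0≤q =
  nonNegative⁻¹ (p · q) {{nonNeg*nonNeg⇒nonNeg p {{nonNegative 0≤p}} q {{nonNegative 0≤q}}}}

·-pos : ∀ {p q} → 0ℚ < p → 0ℚ < q → 0ℚ < p · q
·-pos {p} {q} 0<p 0<q = positive⁻¹ (p · q) {{pos*pos⇒pos p {{positive 0<p}} q {{positive 0<q}}}}

·-mono-≤ : ∀ {p q r s} → 0ℚ ≤ p → 0ℚ ≤ r → p ≤ q → r ≤ s → p · r ≤ q · s
·-mono-≤ 0≤p 0≤r p≤q r≤s = ≤-trans (·-monoʳ-≤ 0≤r p≤q) (·-monoˡ-≤ (≤-trans 0≤p p≤q) r≤s)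

p≤p+q : ∀ {p q} → 0ℚ ≤ q → p ≤ p + q
p≤p+q {p} 0≤q = subst (_≤ p + _) (+-identityʳ p) (+-monoʳ-≤ p 0≤q)

p-q≤p : ∀ {p q} → 0ℚ ≤ q → p - q ≤ p
p-q≤p {p} {q} 0≤q = subst (p - q ≤_) (cancel p q) (p≤p+q 0≤q)
  where
  cancel : ∀ p q → p - q + q ≡ p
  cancel = solve-∀ ℚ-ring

p≤q+p : ∀ {p q} → 0ℚ ≤ q → p ≤ q + p
p≤q+p {p} {q} 0≤q = subst (p ≤_) (+-comm p q) (p≤p+q 0≤q)

+-cancelˡ-≤ : ∀ r {p q} → r + p ≤ r + q → p ≤ q
+-cancelˡ-≤ r {p} {q} r+p≤r+q = subst₂ _≤_ (cancel r p) (cancel r q) (+-monoʳ-≤ (- r) r+p≤r+q)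
  where
  cancel : ∀ r x → - r + (r + x) ≡ x
  cancel = solve-∀ ℚ-ring

+-cancelʳ-≤ : ∀ r {p q} → p + r ≤ q + r → p ≤ q
+-cancelʳ-≤ r {p} {q} p+r≤q+r = +-cancelˡ-≤ r (subst₂ _≤_ (+-comm p r) (+-comm q r) p+r≤q+r)

square-nonNeg : ∀ x → 0ℚ ≤ x ^ 2
square-nonNeg x with ≤-total 0ℚ x
... | inj₁ 0≤x = ·-nonNeg 0≤x 0≤x
... | inj₂ x≤0 = nonNegative⁻¹ (x · x) {{nonPos*nonPos⇒nonPos x {{nonPositive x≤0}} x {{nonPositive x≤0}}}}

square-square : ∀ x → (x ^ 2) ^ 2 ≡ x ^ 4
square-square = solve-∀ ℚ-ring

abs-square : ∀ x → ∣ x ∣ ^ 2 ≡ x ^ 2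
abs-square x = trans (sym (∣p*q∣≡∣p∣*∣q∣ x x)) (0≤p⇒∣p∣≡p (square-nonNeg x))

2xy≤x²+y² : ∀ x y → 2 · x · y ≤ x ^ 2 + y ^ 2
2xy≤x²+y² x y = subst (2 · x · y ≤_) (expand x y) (p≤p+q (square-nonNeg (x - y)))
  where
  expand : ∀ x y → 2 · x · y + (x - y) ^ 2 ≡ x ^ 2 + y ^ 2
  expand = solve-∀ ℚ-ring

^2-cancel-≤ : ∀ {x y} → 0ℚ ≤ y → x ^ 2 ≤ y ^ 2 → x ≤ y
^2-cancel-≤ {x} {y} 0≤y x²≤y² with x ≤? y
... | yes x≤y = x≤y
... | no  x≰y = contradiction (<-≤-trans y²<x² x²≤y²) (<-irrefl refl)
  where
  open ≤-Reasoning
  y<x = ≰⇒> x≰y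
  y²<x² : y · y < x · x
  y²<x² = begin-strict
    y · y  ≤⟨ ·-monoˡ-≤ 0≤y (<⇒≤ y<x) ⟩
    y · x  <⟨ *-monoˡ-<-pos x {{positive (≤-<-trans 0≤y y<x)}} y<x ⟩
    x · x  ∎

ℕtoℚ≡mkℚ : ∀ n → ℕtoℚ n ≡ mkℚ (ℤ.+ n) 0 (coprime-sym (1-coprimeTo n))
ℕtoℚ≡mkℚ n = normalize-coprime (coprime-sym (1-coprimeTo n))

ℕtoℚ-suc : ∀ n → ℕtoℚ (suc n) ≡ 1 + ℕtoℚ n
ℕtoℚ-suc n rewrite ℕtoℚ≡mkℚ n = cong (λ z → (ℤ.+ 1 ℤ.+ z) / 1) (sym (ℤ.*-identityʳ (ℤ.+ n)))

ℕtoℚ-nonNeg : ∀ n → 0ℚ ≤ ℕtoℚ n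
ℕtoℚ-nonNeg zero    = ≤-refl
ℕtoℚ-nonNeg (suc n) = subst (0ℚ ≤_) (sym (ℕtoℚ-suc n)) (+-mono-≤ (nonNegative⁻¹ 1) (ℕtoℚ-nonNeg n))

ℕtoℚ-pos : ∀ {n} → 1 ≤ℕ n → 0ℚ < ℕtoℚ n
ℕtoℚ-pos {suc n} _ = subst (0ℚ <_) (sym (ℕtoℚ-suc n)) (+-mono-<-≤ (positive⁻¹ 1) (ℕtoℚ-nonNeg n))

ℕtoℚ-+ : ∀ a b → ℕtoℚ (a ℕ.+ b) ≡ ℕtoℚ a + ℕtoℚ b
ℕtoℚ-+ zero    b = sym (+-identityˡ (ℕtoℚ b))
ℕtoℚ-+ (suc a) b = begin
  ℕtoℚ (suc (a ℕ.+ b))        ≡⟨ ℕtoℚ-suc (a ℕ.+ b) ⟩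
  1 + ℕtoℚ (a ℕ.+ b)          ≡⟨ cong (1 +_) (ℕtoℚ-+ a b) ⟩
  1 + (ℕtoℚ a + ℕtoℚ b)       ≡⟨ sym (+-assoc 1 (ℕtoℚ a) (ℕtoℚ b)) ⟩
  (1 + ℕtoℚ a) + ℕtoℚ b       ≡⟨ cong (_+ ℕtoℚ b) (sym (ℕtoℚ-suc a)) ⟩
  ℕtoℚ (suc a) + ℕtoℚ b       ∎
  where open ≡-Reasoning

-- Finite sums

sumFin-cong : ∀ {n} {f g : Fin n → ℚ} → (∀ i → f i ≡ g i) → sumFin f ≡ sumFin g
sumFin-cong {zero}  f≗g = refl
sumFin-cong {suc n} f≗g = cong₂ _+_ (f≗g zero) (sumFin-cong (λ i → f≗g (suc i)))

sumFin-zero : ∀ n → sumFin {n} (λ _ → 0ℚ) ≡ 0ℚ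
sumFin-zero zero    = refl
sumFin-zero (suc n) = trans (+-identityˡ _) (sumFin-zero n)

sumFin-distrib-+ : ∀ {n} (f g : Fin n → ℚ) → sumFin (λ i → f i + g i) ≡ sumFin f + sumFin g
sumFin-distrib-+ {zero}  f g = refl
sumFin-distrib-+ {suc n} f g = begin
  (f zero + g zero) + sumFin (λ i → f (suc i) + g (suc i))
    ≡⟨ cong ((f zero + g zero) +_) (sumFin-distrib-+ (λ i → f (suc i)) (λ i → g (suc i))) ⟩
  (f zero + g zero) + (sumFin (λ i → f (suc i)) + sumFin (λ i → g (suc i)))
    ≡⟨ +-interchange (f zero) (g zero) _ _ ⟩
  (f zero + sumFin (λ i → f (suc i))) + (g zero + sumFin (λ i → g (suc i))) ∎
  where open ≡-Reasoning

·-distribˡ-sumFin : ∀ {n} c (f : Fin n → ℚ) → sumFin (λ i → c · f i) ≡ c · sumFin f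
·-distribˡ-sumFin {zero}  c f = sym (*-zeroʳ c)
·-distribˡ-sumFin {suc n} c f =
  trans (cong (c · f zero +_) (·-distribˡ-sumFin c (λ i → f (suc i)))) (sym (*-distribˡ-+ c _ _))

·-distribʳ-sumFin : ∀ {n} c (f : Fin n → ℚ) → sumFin (λ i → f i · c) ≡ sumFin f · c
·-distribʳ-sumFin c f =
  trans (sumFin-cong (λ i → *-comm (f i) c)) (trans (·-distribˡ-sumFin c f) (*-comm c _))

sumFin-neg : ∀ {n} (f : Fin n → ℚ) → sumFin (λ i → - f i) ≡ - sumFin f
sumFin-neg {zero}  f = refl
sumFin-neg {suc n} f =
  trans (cong (- f zero +_) (sumFin-neg (λ i → f (suc i)))) (sym (neg-distrib-+ (f zero) _))

sumFin-distrib-- : ∀ {n} (f g : Fin n → ℚ) → sumFin (λ i → f i - g i) ≡ sumFin f - sumFin g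
sumFin-distrib-- f g = trans (sumFin-distrib-+ f (λ i → - g i)) (cong (sumFin f +_) (sumFin-neg g))

sumFin-comm : ∀ {n k} (f : Fin n → Fin k → ℚ) →
  sumFin (λ i → sumFin (λ j → f i j)) ≡ sumFin (λ j → sumFin (λ i → f i j))
sumFin-comm {zero}  {k} f = sym (sumFin-zero k)
sumFin-comm {suc n} {k} f =
  trans (cong (sumFin (f zero) +_) (sumFin-comm (λ i → f (suc i))))
        (sym (sumFin-distrib-+ (f zero) (λ j → sumFin (λ i → f (suc i) j))))

sumFin-·-sumFin : ∀ {n k} (f : Fin n → ℚ) (g : Fin k → ℚ) →
  sumFin f · sumFin g ≡ sumFin (λ i → sumFin (λ j → f i · g j))
sumFin-·-sumFin f g =
  trans (sym (·-distribʳ-sumFin (sumFin g) f)) (sumFin-cong (λ i → sym (·-distribˡ-sumFin (f i) g)))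

sumFin-mono-≤ : ∀ {n} {f g : Fin n → ℚ} → (∀ i → f i ≤ g i) → sumFin f ≤ sumFin g
sumFin-mono-≤ {zero}  f≤g = ≤-refl
sumFin-mono-≤ {suc n} f≤g = +-mono-≤ (f≤g zero) (sumFin-mono-≤ (λ i → f≤g (suc i)))

sumFin-nonNeg : ∀ {n} {f : Fin n → ℚ} → (∀ i → 0ℚ ≤ f i) → 0ℚ ≤ sumFin f
sumFin-nonNeg {n} {f} 0≤f = subst (_≤ sumFin f) (sumFin-zero n) (sumFin-mono-≤ 0≤f)

sumFin-const : ∀ n c → sumFin {n} (λ _ → c) ≡ ℕtoℚ n · c
sumFin-const zero    c = sym (*-zeroˡ c)
sumFin-const (suc n) c = begin
  c + sumFin {n} (λ _ → c)  ≡⟨ cong (c +_) (sumFin-const n c) ⟩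
  c + ℕtoℚ n · c            ≡⟨ step c (ℕtoℚ n) ⟩
  (1 + ℕtoℚ n) · c          ≡⟨ cong (_· c) (sym (ℕtoℚ-suc n)) ⟩
  ℕtoℚ (suc n) · c          ∎
  where
  open ≡-Reasoning
  step : ∀ c x → c + x · c ≡ (1 + x) · c
  step = solve-∀ ℚ-ring

cauchy-schwarz-sumFin : ∀ {n} (f : Fin n → ℚ) → sumFin f ^ 2 ≤ ℕtoℚ n · sumFin (λ i → f i ^ 2)
cauchy-schwarz-sumFin {zero}  f = ≤-refl
cauchy-schwarz-sumFin {suc n} f = ·-cancelˡ-≤ (ℕtoℚ-pos {suc n} (s≤s z≤n)) (+-cancelˡ-≤ (N · S ^ 2) (begin
  N · S ^ 2 + N · S ^ 2                  ≡⟨ double N S ⟩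
  2 · N · S · S                           ≡⟨ sym (·-distribˡ-sumFin (2 · N · S) f) ⟩
  sumFin (λ i → 2 · N · S · f i)          ≤⟨ sumFin-mono-≤ (λ i → pointwise (f i)) ⟩
  sumFin (λ i → S ^ 2 + N ^ 2 · f i ^ 2)  ≡⟨ sumFin-distrib-+ (λ _ → S ^ 2) (λ i → N ^ 2 · f i ^ 2) ⟩
  sumFin {suc n} (λ _ → S ^ 2) + sumFin (λ i → N ^ 2 · f i ^ 2)
    ≡⟨ cong₂ _+_ (sumFin-const (suc n) (S ^ 2)) (·-distribˡ-sumFin (N ^ 2) (λ i → f i ^ 2)) ⟩
  N · S ^ 2 + N ^ 2 · Q                   ≡⟨ cong (N · S ^ 2 +_) (*-assoc N N Q) ⟩
  N · S ^ 2 + N · (N · Q)                 ∎))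
  where
  open ≤-Reasoning
  N = ℕtoℚ (suc n)
  S = sumFin f
  Q = sumFin (λ i → f i ^ 2)
  double : ∀ N S → N · S ^ 2 + N · S ^ 2 ≡ 2 · N · S · S
  double = solve-∀ ℚ-ring
  pointwise : ∀ y → 2 · N · S · y ≤ S ^ 2 + N ^ 2 · y ^ 2
  pointwise y = subst₂ _≤_ (reassoc N S y) (cong (S ^ 2 +_) (square-· N y)) (2xy≤x²+y² S (N · y))
    where
    reassoc : ∀ N S y → 2 · S · (N · y) ≡ 2 · N · S · y
    reassoc = solve-∀ ℚ-ring
    square-· : ∀ N y → (N · y) ^ 2 ≡ N ^ 2 · y ^ 2
    square-· = solve-∀ ℚ-ring

cauchy-schwarz-sumFin² : ∀ {n} (f : Fin n → Fin n → ℚ) →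
  sumFin (λ i → sumFin (f i)) ^ 2 ≤ ℕtoℚ n · (ℕtoℚ n · sumFin (λ i → sumFin (λ j → f i j ^ 2)))
cauchy-schwarz-sumFin² {n} f = begin
  sumFin (λ i → sumFin (f i)) ^ 2                          ≤⟨ cauchy-schwarz-sumFin (λ i → sumFin (f i)) ⟩
  ℕtoℚ n · sumFin (λ i → sumFin (f i) ^ 2)
    ≤⟨ ·-monoˡ-≤ (ℕtoℚ-nonNeg n) (sumFin-mono-≤ (λ i → cauchy-schwarz-sumFin (f i))) ⟩
  ℕtoℚ n · sumFin (λ i → ℕtoℚ n · sumFin (λ j → f i j ^ 2))
    ≡⟨ cong (ℕtoℚ n ·_) (·-distribˡ-sumFin (ℕtoℚ n) (λ i → sumFin (λ j → f i j ^ 2))) ⟩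
  ℕtoℚ n · (ℕtoℚ n · sumFin (λ i → sumFin (λ j → f i j ^ 2))) ∎
  where open ≤-Reasoning

sumFin-squares-≤-square : ∀ {n} (f : Fin n → ℚ) → (∀ i → 0ℚ ≤ f i) → sumFin (λ i → f i ^ 2) ≤ sumFin f ^ 2
sumFin-squares-≤-square {zero}  f 0≤f = ≤-refl
sumFin-squares-≤-square {suc n} f 0≤f = begin
  f zero ^ 2 + sumFin (λ i → f (suc i) ^ 2)
    ≤⟨ +-monoʳ-≤ (f zero ^ 2) (sumFin-squares-≤-square (tail f) (λ i → 0≤f (suc i))) ⟩
  f zero ^ 2 + S ^ 2
    ≤⟨ p≤p+q (·-nonNeg (·-nonNeg (nonNegative⁻¹ 2) (0≤f zero)) (sumFin-nonNeg (λ i → 0≤f (suc i)))) ⟩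
  f zero ^ 2 + S ^ 2 + 2 · f zero · S         ≡⟨ expand (f zero) S ⟩
  (f zero + S) ^ 2                            ∎
  where
  open ≤-Reasoning
  S = sumFin (tail f)
  expand : ∀ a S → a ^ 2 + S ^ 2 + 2 · a · S ≡ (a + S) ^ 2
  expand = solve-∀ ℚ-ring

-- Sums over lists and the second moment method

sumList : {A : Set} → List A → (A → ℚ) → ℚ
sumList []       f = 0ℚ
sumList (x ∷ xs) f = f x + sumList xs f

indicator : {A : Set} {P : Pred A 0ℓ} → Decidable P → A → ℚ
indicator P? x with does (P? x)
... | true  = 1
... | false = 0

indicator-cases : ∀ {A : Set} {P : Pred A 0ℓ} (P? : Decidable P) x →
  (P x × indicator P? x ≡ 1) ⊎ (¬ P x × indicator P? x ≡ 0)
indicator-cases P? x with P? x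
... | yes px  = inj₁ (px , refl)
... | no  ¬px = inj₂ (¬px , refl)

module _ {A : Set} where

  sumList-cong : ∀ (xs : List A) {f g : A → ℚ} → (∀ x → f x ≡ g x) → sumList xs f ≡ sumList xs g
  sumList-cong []       f≗g = refl
  sumList-cong (x ∷ xs) f≗g = cong₂ _+_ (f≗g x) (sumList-cong xs f≗g)

  sumList-zero : ∀ (xs : List A) → sumList xs (λ _ → 0ℚ) ≡ 0ℚ
  sumList-zero []       = refl
  sumList-zero (x ∷ xs) = trans (+-identityˡ _) (sumList-zero xs)

  sumList-distrib-+ : ∀ (xs : List A) (f g : A → ℚ) →
    sumList xs (λ x → f x + g x) ≡ sumList xs f + sumList xs g
  sumList-distrib-+ []       f g = refl
  sumList-distrib-+ (x ∷ xs) f g =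
    trans (cong (f x + g x +_) (sumList-distrib-+ xs f g)) (+-interchange (f x) (g x) _ _)

  ·-distribˡ-sumList : ∀ (xs : List A) c (f : A → ℚ) → sumList xs (λ x → c · f x) ≡ c · sumList xs f
  ·-distribˡ-sumList []       c f = sym (*-zeroʳ c)
  ·-distribˡ-sumList (x ∷ xs) c f =
    trans (cong (c · f x +_) (·-distribˡ-sumList xs c f)) (sym (*-distribˡ-+ c _ _))

  ·-distribʳ-sumList : ∀ (xs : List A) c (f : A → ℚ) → sumList xs (λ x → f x · c) ≡ sumList xs f · c
  ·-distribʳ-sumList xs c f =
    trans (sumList-cong xs (λ x → *-comm (f x) c)) (trans (·-distribˡ-sumList xs c f) (*-comm c _))

  sumList-mono-≤ : ∀ (xs : List A) {f g : A → ℚ} → (∀ x → f x ≤ g x) → sumList xs f ≤ sumList xs g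
  sumList-mono-≤ []       f≤g = ≤-refl
  sumList-mono-≤ (x ∷ xs) f≤g = +-mono-≤ (f≤g x) (sumList-mono-≤ xs f≤g)

  sumList-nonNeg : ∀ (xs : List A) {f : A → ℚ} → (∀ x → 0ℚ ≤ f x) → 0ℚ ≤ sumList xs f
  sumList-nonNeg xs {f} 0≤f = subst (_≤ sumList xs f) (sumList-zero xs) (sumList-mono-≤ xs 0≤f)

  sumList-++ : ∀ (xs ys : List A) (f : A → ℚ) → sumList (xs ++ ys) f ≡ sumList xs f + sumList ys f
  sumList-++ []       ys f = sym (+-identityˡ _)
  sumList-++ (x ∷ xs) ys f = trans (cong (f x +_) (sumList-++ xs ys f)) (sym (+-assoc (f x) _ _))

  sumList-sumFin : ∀ {n} (xs : List A) (f : A → Fin n → ℚ) →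
    sumList xs (λ x → sumFin (f x)) ≡ sumFin (λ i → sumList xs (λ x → f x i))
  sumList-sumFin {n} []       f = sym (sumFin-zero n)
  sumList-sumFin     (x ∷ xs) f =
    trans (cong (sumFin (f x) +_) (sumList-sumFin xs f)) (sym (sumFin-distrib-+ (f x) _))

  ℕtoℚ-length : ∀ (xs : List A) → ℕtoℚ (length xs) ≡ sumList xs (λ _ → 1)
  ℕtoℚ-length []       = refl
  ℕtoℚ-length (x ∷ xs) = trans (ℕtoℚ-suc (length xs)) (cong (1 +_) (ℕtoℚ-length xs))

  ℕtoℚ-length-filter : ∀ {P : Pred A 0ℓ} (P? : Decidable P) (xs : List A) →
    ℕtoℚ (length (filter P? xs)) ≡ sumList xs (indicator P?)
  ℕtoℚ-length-filter P? []       = refl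
  ℕtoℚ-length-filter P? (x ∷ xs) with does (P? x)
  ... | true  = trans (ℕtoℚ-suc (length (filter P? xs))) (cong (1 +_) (ℕtoℚ-length-filter P? xs))
  ... | false = trans (ℕtoℚ-length-filter P? xs) (sym (+-identityˡ _))

sumList-map : ∀ {A B : Set} (g : A → B) (xs : List A) (f : B → ℚ) →
  sumList (map g xs) f ≡ sumList xs (λ x → f (g x))
sumList-map g []       f = refl
sumList-map g (x ∷ xs) f = cong (f (g x) +_) (sumList-map g xs f)

module _ {A B : Set} where

  sumList-comm : ∀ (xs : List A) (ys : List B) (f : A → B → ℚ) →
    sumList xs (λ x → sumList ys (f x)) ≡ sumList ys (λ y → sumList xs (λ x → f x y))
  sumList-comm []       ys f = sym (sumList-zero ys)
  sumList-comm (x ∷ xs) ys f =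
    trans (cong (sumList ys (f x) +_) (sumList-comm xs ys f)) (sym (sumList-distrib-+ ys (f x) _))

  sumList-cartesianProduct : ∀ (xs : List A) (ys : List B) (f : A × B → ℚ) →
    sumList (cartesianProduct xs ys) f ≡ sumList xs (λ x → sumList ys (λ y → f (x , y)))
  sumList-cartesianProduct []       ys f = refl
  sumList-cartesianProduct (x ∷ xs) ys f =
    trans (sumList-++ (map (x ,_) ys) (cartesianProduct xs ys) f)
          (cong₂ _+_ (sumList-map (x ,_) ys f) (sumList-cartesianProduct xs ys f))

  sumList-·-sumList : ∀ (xs : List A) (ys : List B) (f : A → ℚ) (g : B → ℚ) →
    sumList xs f · sumList ys g ≡ sumList xs (λ x → sumList ys (λ y → f x · g y))
  sumList-·-sumList xs ys f g =
    trans (sym (·-distribʳ-sumList xs (sumList ys g) f))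
          (sumList-cong xs (λ x → sym (·-distribˡ-sumList ys (f x) g)))

module _ {A : Set} where

  cauchy-schwarz-sumList : ∀ (xs : List A) (f g : A → ℚ) →
    sumList xs (λ x → f x · g x) ^ 2 ≤ sumList xs (λ x → f x ^ 2) · sumList xs (λ x → g x ^ 2)
  cauchy-schwarz-sumList xs f g = ·-cancelˡ-≤ (positive⁻¹ 2) (begin
    2 · P ^ 2                                               ≤⟨ p≤q+p L-nonNeg ⟩
    L + 2 · P ^ 2                                           ≡⟨ cong (L +_) twice-P² ⟩
    L + ∑∑ (λ x y → 2 · (f x · g x) · (f y · g y))          ≡⟨ sym (∑∑-distrib-+ _ _) ⟩
    ∑∑ (λ x y → (f x · g y - f y · g x) ^ 2 + 2 · (f x · g x) · (f y · g y))
      ≡⟨ sumList-cong xs (λ x → sumList-cong xs (λ y → lagrange (f x) (g x) (f y) (g y))) ⟩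
    ∑∑ (λ x y → f x ^ 2 · g y ^ 2 + g x ^ 2 · f y ^ 2)      ≡⟨ ∑∑-distrib-+ _ _ ⟩
    ∑∑ (λ x y → f x ^ 2 · g y ^ 2) + ∑∑ (λ x y → g x ^ 2 · f y ^ 2)
      ≡⟨ sym (cong₂ _+_ (sumList-·-sumList xs xs _ _) (sumList-·-sumList xs xs _ _)) ⟩
    F · G + G · F                                           ≡⟨ cong (F · G +_) (*-comm G F) ⟩
    F · G + F · G                                           ≡⟨ double (F · G) ⟩
    2 · (F · G)                                             ∎)
    where
    open ≤-Reasoning
    P = sumList xs (λ x → f x · g x)
    F = sumList xs (λ x → f x ^ 2)
    G = sumList xs (λ x → g x ^ 2)
    ∑∑ : (A → A → ℚ) → ℚ
    ∑∑ h = sumList xs (λ x → sumList xs (h x))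
    ∑∑-distrib-+ : ∀ h k → ∑∑ (λ x y → h x y + k x y) ≡ ∑∑ h + ∑∑ k
    ∑∑-distrib-+ h k =
      trans (sumList-cong xs (λ x → sumList-distrib-+ xs (h x) (k x))) (sumList-distrib-+ xs _ _)
    L = ∑∑ (λ x y → (f x · g y - f y · g x) ^ 2)
    L-nonNeg : 0ℚ ≤ L
    L-nonNeg = sumList-nonNeg xs (λ x → sumList-nonNeg xs (λ y → square-nonNeg (f x · g y - f y · g x)))
    twice-P² : 2 · P ^ 2 ≡ ∑∑ (λ x y → 2 · (f x · g x) · (f y · g y))
    twice-P² = begin-equality
      2 · (P · P)                                       ≡⟨ cong (2 ·_) (sumList-·-sumList xs xs _ _) ⟩
      2 · ∑∑ (λ x y → (f x · g x) · (f y · g y))        ≡⟨ sym (·-distribˡ-sumList xs 2 _) ⟩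
      sumList xs (λ x → 2 · sumList xs (λ y → (f x · g x) · (f y · g y)))
        ≡⟨ sumList-cong xs (λ x → sym (·-distribˡ-sumList xs 2 _)) ⟩
      sumList xs (λ x → sumList xs (λ y → 2 · ((f x · g x) · (f y · g y))))
        ≡⟨ sumList-cong xs (λ x → sumList-cong xs (λ y → sym (*-assoc 2 (f x · g x) (f y · g y)))) ⟩
      ∑∑ (λ x y → 2 · (f x · g x) · (f y · g y))         ∎
    lagrange : ∀ a b c d → (a · d - c · b) ^ 2 + 2 · (a · b) · (c · d) ≡ a ^ 2 · d ^ 2 + b ^ 2 · c ^ 2
    lagrange = solve-∀ ℚ-ring
    double : ∀ x → x + x ≡ 2 · x
    double = solve-∀ ℚ-ring

  sumList-·-≤ : ∀ (xs : List A) {f g : A → ℚ} {c a b : ℚ} → 0ℚ ≤ c → 0ℚ ≤ a → 0ℚ ≤ b →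
    sumList xs (λ x → f x ^ 2) ≤ c · a ^ 2 → sumList xs (λ x → g x ^ 2) ≤ c · b ^ 2 →
    sumList xs (λ x → f x · g x) ≤ c · (a · b)
  sumList-·-≤ xs {f} {g} {c} {a} {b} 0≤c 0≤a 0≤b F≤ca² G≤cb² =
    ^2-cancel-≤ (·-nonNeg 0≤c (·-nonNeg 0≤a 0≤b)) (begin
      sumList xs (λ x → f x · g x) ^ 2                       ≤⟨ cauchy-schwarz-sumList xs f g ⟩
      sumList xs (λ x → f x ^ 2) · sumList xs (λ x → g x ^ 2)
        ≤⟨ ·-mono-≤ (sumList-nonNeg xs (λ x → square-nonNeg (f x)))
                    (sumList-nonNeg xs (λ x → square-nonNeg (g x))) F≤ca² G≤cb² ⟩
      (c · a ^ 2) · (c · b ^ 2)                              ≡⟨ regroup c a b ⟩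
      (c · (a · b)) ^ 2                                      ∎)
    where
    open ≤-Reasoning
    regroup : ∀ c a b → (c · a ^ 2) · (c · b ^ 2) ≡ (c · (a · b)) ^ 2
    regroup = solve-∀ ℚ-ring

  paley-zygmund : ∀ (xs : List A) {E : Pred A 0ℓ} (E? : Decidable E) (V : A → ℚ) {t θ : ℚ} →
    0ℚ ≤ t → 0ℚ ≤ θ → (∀ x → ¬ E x → V x ≤ t) →
    2 · θ · sumList xs V
      ≤ 2 · θ · t · sumList xs (λ _ → 1) + (θ ^ 2 · sumList xs (indicator E?) + sumList xs (λ x → V x ^ 2))
  paley-zygmund xs E? V {t} {θ} 0≤t 0≤θ small = begin
    2 · θ · sumList xs V                    ≡⟨ sym (·-distribˡ-sumList xs (2 · θ) V) ⟩
    sumList xs (λ x → 2 · θ · V x)          ≤⟨ sumList-mono-≤ xs pointwise ⟩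
    sumList xs (λ x → 2 · θ · t · 1 + (θ ^ 2 · indicator E? x + V x ^ 2))
      ≡⟨ sumList-distrib-+ xs (λ _ → 2 · θ · t · 1) _ ⟩
    sumList xs (λ _ → 2 · θ · t · 1) + sumList xs (λ x → θ ^ 2 · indicator E? x + V x ^ 2)
      ≡⟨ cong₂ _+_ (·-distribˡ-sumList xs (2 · θ · t) (λ _ → 1))
                   (trans (sumList-distrib-+ xs (λ x → θ ^ 2 · indicator E? x) _)
                          (cong (_+ _) (·-distribˡ-sumList xs (θ ^ 2) (indicator E?)))) ⟩
    2 · θ · t · sumList xs (λ _ → 1) + (θ ^ 2 · sumList xs (indicator E?) + sumList xs (λ x → V x ^ 2)) ∎
    where
    open ≤-Reasoning
    0≤2θt : 0ℚ ≤ 2 · θ · t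
    0≤2θt = ·-nonNeg (·-nonNeg (nonNegative⁻¹ 2) 0≤θ) 0≤t
    pointwise : ∀ x → 2 · θ · V x ≤ 2 · θ · t · 1 + (θ ^ 2 · indicator E? x + V x ^ 2)
    pointwise x with indicator-cases E? x
    ... | inj₁ (_ , 𝟙≡1) rewrite 𝟙≡1 = begin
      2 · θ · V x                              ≤⟨ 2xy≤x²+y² θ (V x) ⟩
      θ ^ 2 + V x ^ 2                          ≤⟨ p≤q+p 0≤2θt ⟩
      2 · θ · t + (θ ^ 2 + V x ^ 2)            ≡⟨ unit-factors (2 · θ · t) (θ ^ 2) (V x ^ 2) ⟩
      2 · θ · t · 1 + (θ ^ 2 · 1 + V x ^ 2)    ∎
      where
      unit-factors : ∀ a b c → a + (b + c) ≡ a · 1 + (b · 1 + c)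
      unit-factors = solve-∀ ℚ-ring
    ... | inj₂ (¬Ex , 𝟙≡0) rewrite 𝟙≡0 = begin
      2 · θ · V x
        ≤⟨ ·-monoˡ-≤ (·-nonNeg (nonNegative⁻¹ 2) 0≤θ) (small x ¬Ex) ⟩
      2 · θ · t                                ≤⟨ p≤p+q (square-nonNeg (V x)) ⟩
      2 · θ · t + V x ^ 2                      ≡⟨ unit-factors (2 · θ · t) (θ ^ 2) (V x ^ 2) ⟩
      2 · θ · t · 1 + (θ ^ 2 · 0 + V x ^ 2)    ∎
      where
      unit-factors : ∀ a b c → a + c ≡ a · 1 + (b · 0 + c)
      unit-factors = solve-∀ ℚ-ring

-- Subsets of a given size

filter-map : ∀ {A B : Set} {P : Pred B 0ℓ} {Q : Pred A 0ℓ} (P? : Decidable P) (Q? : Decidable Q)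
  (g : A → B) → (∀ x → does (P? (g x)) ≡ does (Q? x)) →
  ∀ xs → filter P? (map g xs) ≡ map g (filter Q? xs)
filter-map P? Q? g same []       = refl
filter-map P? Q? g same (x ∷ xs) with does (P? (g x)) | does (Q? x) | same x
... | true  | true  | refl = cong (g x ∷_) (filter-map P? Q? g same xs)
... | false | false | refl = filter-map P? Q? g same xs

subsetsOfSize-suc : ∀ n m → subsetsOfSize (suc n) (suc m)
  ≡ map (inside ∷_) (subsetsOfSize n m) ++ map (outside ∷_) (subsetsOfSize n (suc m))
subsetsOfSize-suc n m = trans (filter-++ P? (map (inside ∷_) all) (map (outside ∷_) all))
  (cong₂ _++_ (filter-map P? (λ S → size S ℕ.≟ m) (inside ∷_) (λ _ → refl) all)
              (filter-map P? (λ S → size S ℕ.≟ suc m) (outside ∷_) (λ _ → refl) all))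
  where
  all = allSubsets n
  P? : Decidable (λ (S : Subset (suc n)) → size S ≡ suc m)
  P? S = size S ℕ.≟ suc m

subsetsOfSize-zero : ∀ n → subsetsOfSize (suc n) 0 ≡ map (outside ∷_) (subsetsOfSize n 0)
subsetsOfSize-zero n = trans (filter-++ P? (map (inside ∷_) all) (map (outside ∷_) all))
  (cong₂ _++_ (filter-none P? (All.map⁺ (All.universal (λ _ ()) all)))
              (filter-map P? (λ S → size S ℕ.≟ 0) (outside ∷_) (λ _ → refl) all))
  where
  all = allSubsets n
  P? : Decidable (λ (S : Subset (suc n)) → size S ≡ 0)
  P? S = size S ℕ.≟ 0

𝟙-suc : ∀ {n} b (S : Subset n) i → 𝟙 (b ∷ S) (suc i) ≡ 𝟙 S i
𝟙-suc b S i with lookup S i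
... | true  = refl
... | false = refl

mass-inside : ∀ {n} (u : Fin (suc n) → ℚ) S → mass u (inside ∷ S) ≡ u zero + mass (tail u) S
mass-inside u S =
  cong₂ _+_ (*-identityˡ (u zero)) (sumFin-cong (λ i → cong (_· u (suc i)) (𝟙-suc inside S i)))

mass-outside : ∀ {n} (u : Fin (suc n) → ℚ) S → mass u (outside ∷ S) ≡ mass (tail u) S
mass-outside u S =
  trans (cong₂ _+_ (*-zeroˡ (u zero)) (sumFin-cong (λ i → cong (_· u (suc i)) (𝟙-suc outside S i))))
        (+-identityˡ _)

sumList-subsetsOfSize-suc : ∀ n m (f : Subset (suc n) → ℚ) →
  sumList (subsetsOfSize (suc n) (suc m)) f
    ≡ sumList (subsetsOfSize n m) (λ S → f (inside ∷ S))
      + sumList (subsetsOfSize n (suc m)) (λ S → f (outside ∷ S))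
sumList-subsetsOfSize-suc n m f = begin
  sumList (subsetsOfSize (suc n) (suc m)) f
    ≡⟨ cong (λ Ss → sumList Ss f) (subsetsOfSize-suc n m) ⟩
  sumList (map (inside ∷_) (subsetsOfSize n m) ++ map (outside ∷_) (subsetsOfSize n (suc m))) f
    ≡⟨ sumList-++ (map (inside ∷_) (subsetsOfSize n m)) _ f ⟩
  sumList (map (inside ∷_) (subsetsOfSize n m)) f + sumList (map (outside ∷_) (subsetsOfSize n (suc m))) f
    ≡⟨ cong₂ _+_ (sumList-map (inside ∷_) (subsetsOfSize n m) f)
                 (sumList-map (outside ∷_) (subsetsOfSize n (suc m)) f) ⟩
  sumList (subsetsOfSize n m) (λ S → f (inside ∷ S))
    + sumList (subsetsOfSize n (suc m)) (λ S → f (outside ∷ S)) ∎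
  where open ≡-Reasoning

sumList-subsetsOfSize-zero : ∀ n (u : Fin n → ℚ) (f : ℚ → ℚ) →
  sumList (subsetsOfSize n 0) (λ S → f (mass u S)) ≡ f 0ℚ + 0ℚ
sumList-subsetsOfSize-zero zero    u f = refl
sumList-subsetsOfSize-zero (suc n) u f = begin
  sumList (subsetsOfSize (suc n) 0) (λ S → f (mass u S))
    ≡⟨ cong (λ Ss → sumList Ss (λ S → f (mass u S))) (subsetsOfSize-zero n) ⟩
  sumList (map (outside ∷_) (subsetsOfSize n 0)) (λ S → f (mass u S))
    ≡⟨ sumList-map (outside ∷_) (subsetsOfSize n 0) (λ S → f (mass u S)) ⟩
  sumList (subsetsOfSize n 0) (λ S → f (mass u (outside ∷ S)))
    ≡⟨ sumList-cong (subsetsOfSize n 0) (λ S → cong f (mass-outside u S)) ⟩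
  sumList (subsetsOfSize n 0) (λ S → f (mass (tail u) S))
    ≡⟨ sumList-subsetsOfSize-zero n (tail u) f ⟩
  f 0ℚ + 0ℚ ∎
  where open ≡-Reasoning

-- C j n m = C(n − j, m − j), the number of m-subsets of an n-set containing a fixed j-subset.
-- For n < j the values are those forced by Pascal's rule (binomials with negative upper
-- index), so that C-pascal and C-suc-size hold for every n.
C : ℕ → ℕ → ℕ → ℚ
C zero    zero    zero    = 1
C zero    zero    (suc m) = 0
C zero    (suc n) zero    = 1
C zero    (suc n) (suc m) = C zero n m + C zero n (suc m)
C (suc j) n       zero    = 0
C (suc j) zero    (suc m) = C j zero m - C (suc j) zero m
C (suc j) (suc n) (suc m) = C j n m

C-zero-size : ∀ n → C 0 n 0 ≡ 1
C-zero-size zero    = refl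
C-zero-size (suc n) = refl

C-pascal : ∀ j n m → C j (suc n) (suc m) ≡ C j n m + C j n (suc m)
C-pascal zero    n       m       = refl
C-pascal (suc j) zero    m       = cancel (C j 0 m) (C (suc j) 0 m)
  where
  cancel : ∀ x y → x ≡ y + (x - y)
  cancel = solve-∀ ℚ-ring
C-pascal (suc j) (suc n) zero    = trans (C-suc-zero j n) (sym (+-identityˡ _))
  where
  C-suc-zero : ∀ j n → C j (suc n) 0 ≡ C j n 0
  C-suc-zero zero    n = sym (C-zero-size n)
  C-suc-zero (suc j) n = refl
C-pascal (suc j) (suc n) (suc m) = C-pascal j n m

C-suc-size : ∀ j n m → C (suc j) n (suc m) ≡ C j n m - C (suc j) n m
C-suc-size j n m = trans (cancel (C (suc j) n m) (C (suc j) n (suc m)))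
                         (cong (_- C (suc j) n m) (sym (C-pascal (suc j) n m)))
  where
  cancel : ∀ x y → y ≡ (x + y) - x
  cancel = solve-∀ ℚ-ring

count-subsetsOfSize : ∀ n m → sumList (subsetsOfSize n m) (λ _ → 1) ≡ C 0 n m
count-subsetsOfSize n       zero    =
  trans (sumList-subsetsOfSize-zero n (λ _ → 0ℚ) (λ _ → 1)) (trans (+-identityʳ 1) (sym (C-zero-size n)))
count-subsetsOfSize zero    (suc m) = refl
count-subsetsOfSize (suc n) (suc m) = trans (sumList-subsetsOfSize-suc n m (λ _ → 1))
  (cong₂ _+_ (count-subsetsOfSize n m) (count-subsetsOfSize n (suc m)))

C₀-nonNeg : ∀ n m → 0ℚ ≤ C 0 n m
C₀-nonNeg zero    zero    = nonNegative⁻¹ 1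
C₀-nonNeg zero    (suc m) = ≤-refl
C₀-nonNeg (suc n) zero    = nonNegative⁻¹ 1
C₀-nonNeg (suc n) (suc m) = +-mono-≤ (C₀-nonNeg n m) (C₀-nonNeg n (suc m))

C-nonNeg : ∀ j n m → m ≤ℕ n → 0ℚ ≤ C j n m
C-nonNeg zero    n       m       _         = C₀-nonNeg n m
C-nonNeg (suc j) n       zero    _         = ≤-refl
C-nonNeg (suc j) (suc n) (suc m) (s≤s m≤n) = C-nonNeg j n m m≤n

C-antitone : ∀ j n m → suc m ≤ℕ n → C (suc j) n m ≤ C j n m
C-antitone j n m m<n = subst (C (suc j) n m ≤_) (cancel (C j n m) (C (suc j) n m))
  (p≤p+q (subst (0ℚ ≤_) (C-suc-size j n m) (C-nonNeg (suc j) n (suc m) m<n)))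
  where
  cancel : ∀ x y → y + (x - y) ≡ x
  cancel = solve-∀ ℚ-ring

C≤C₀ : ∀ j n m → suc m ≤ℕ n → C j n m ≤ C 0 n m
C≤C₀ zero    n m m<n = ≤-refl
C≤C₀ (suc j) n m m<n = ≤-trans (C-antitone j n m m<n) (C≤C₀ j n m m<n)

C₀-absorption : ∀ n k → (ℕtoℚ k + 1) · C 0 n (suc k) ≡ (ℕtoℚ n - ℕtoℚ k) · C 0 n k
C₀-absorption zero    zero    = refl
C₀-absorption zero    (suc k) = trans (*-zeroʳ (ℕtoℚ (suc k) + 1)) (sym (*-zeroʳ (ℕtoℚ 0 - ℕtoℚ (suc k))))
C₀-absorption (suc n) zero    =
  base (ℕtoℚ n) (C 0 n 1) (ℕtoℚ-suc n) (C-zero-size n) (C₀-absorption n 0)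
  where
  base : ∀ N {N′ c₀} x → N′ ≡ 1 + N → c₀ ≡ 1 → (0ℚ + 1) · x ≡ (N - 0ℚ) · c₀ →
    (0ℚ + 1) · (c₀ + x) ≡ (N′ - 0ℚ) · 1
  base N x refl refl hyp = begin
    (0ℚ + 1) · (1 + x)     ≡⟨ regroup₁ x ⟩
    1 + (0ℚ + 1) · x       ≡⟨ cong (1 +_) hyp ⟩
    1 + (N - 0ℚ) · 1       ≡⟨ regroup₂ N ⟩
    (1 + N - 0ℚ) · 1       ∎
    where
    open ≡-Reasoning
    regroup₁ : ∀ x → (0ℚ + 1) · (1 + x) ≡ 1 + (0ℚ + 1) · x
    regroup₁ = solve-∀ ℚ-ring
    regroup₂ : ∀ N → 1 + (N - 0ℚ) · 1 ≡ (1 + N - 0ℚ) · 1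
    regroup₂ = solve-∀ ℚ-ring
C₀-absorption (suc n) (suc k) =
  step (ℕtoℚ n) (ℕtoℚ k) (C 0 n k) (C 0 n (suc k)) (C 0 n (suc (suc k)))
       (ℕtoℚ-suc n) (ℕtoℚ-suc k) (C₀-absorption n k) (C₀-absorption n (suc k))
  where
  step : ∀ N K {N′ K′} x y z → N′ ≡ 1 + N → K′ ≡ 1 + K →
    (K + 1) · y ≡ (N - K) · x → (K′ + 1) · z ≡ (N - K′) · y → (K′ + 1) · (y + z) ≡ (N′ - K′) · (x + y)
  step N K x y z refl refl hyp₁ hyp₂ = begin
    (1 + K + 1) · (y + z)                         ≡⟨ *-distribˡ-+ (1 + K + 1) y z ⟩
    (1 + K + 1) · y + (1 + K + 1) · z             ≡⟨ cong ((1 + K + 1) · y +_) hyp₂ ⟩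
    (1 + K + 1) · y + (N - (1 + K)) · y           ≡⟨ regroup₁ N K y ⟩
    (1 + N - (1 + K)) · y + (K + 1) · y           ≡⟨ cong ((1 + N - (1 + K)) · y +_) hyp₁ ⟩
    (1 + N - (1 + K)) · y + (N - K) · x           ≡⟨ regroup₂ N K x y ⟩
    (1 + N - (1 + K)) · (x + y)                   ∎
    where
    open ≡-Reasoning
    regroup₁ : ∀ N K y → (1 + K + 1) · y + (N - (1 + K)) · y ≡ (1 + N - (1 + K)) · y + (K + 1) · y
    regroup₁ = solve-∀ ℚ-ring
    regroup₂ : ∀ N K x y → (1 + N - (1 + K)) · y + (N - K) · x ≡ (1 + N - (1 + K)) · (x + y)
    regroup₂ = solve-∀ ℚ-ring

absorb-≤ : ∀ {a p q} → 0ℚ ≤ a → 0ℚ ≤ q → (a + 1) · p ≡ a · q → p ≤ q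
absorb-≤ {a} {p} {q} 0≤a 0≤q eq = ·-cancelˡ-≤ 0<a+1 (begin
  (a + 1) · p  ≡⟨ eq ⟩
  a · q        ≤⟨ p≤p+q 0≤q ⟩
  a · q + q    ≡⟨ regroup a q ⟩
  (a + 1) · q  ∎)
  where
  open ≤-Reasoning
  0<a+1 = +-mono-≤-< 0≤a (positive⁻¹ 1)
  regroup : ∀ a q → a · q + q ≡ (a + 1) · q
  regroup = solve-∀ ℚ-ring

-- C(2M+2, M+1) = C(2M, M−1) + 2 C(2M, M) + C(2M, M+1), and the middle binomial is the largest.
central-binomial-≤ : ∀ M → C 0 (suc (suc (M ℕ.+ M))) (suc M) ≤ 4 · C 0 (M ℕ.+ M) M
central-binomial-≤ zero    = ≤ᵇ⇒≤ tt
central-binomial-≤ (suc K) = begin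
  (x + y) + (y + z)  ≤⟨ +-mono-≤ (+-monoˡ-≤ y x≤y) (+-monoʳ-≤ y z≤y) ⟩
  (y + y) + (y + y)  ≡⟨ four y ⟩
  4 · y              ∎
  where
  open ≤-Reasoning
  M = suc K
  x = C 0 (M ℕ.+ M) K
  y = C 0 (M ℕ.+ M) M
  z = C 0 (M ℕ.+ M) (suc M)
  four : ∀ y → (y + y) + (y + y) ≡ 4 · y
  four = solve-∀ ℚ-ring
  z≤y : z ≤ y
  z≤y = absorb-≤ (ℕtoℚ-nonNeg M) (C₀-nonNeg (M ℕ.+ M) M)
    (trans (C₀-absorption (M ℕ.+ M) M) (cong (_· y) (begin-equality
      ℕtoℚ (M ℕ.+ M) - ℕtoℚ M       ≡⟨ cong (_- ℕtoℚ M) (ℕtoℚ-+ M M) ⟩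
      ℕtoℚ M + ℕtoℚ M - ℕtoℚ M      ≡⟨ cancel (ℕtoℚ M) ⟩
      ℕtoℚ M                        ∎)))
    where
    cancel : ∀ a → a + a - a ≡ a
    cancel = solve-∀ ℚ-ring
  x≤y : x ≤ y
  x≤y = absorb-≤ (+-mono-≤ (ℕtoℚ-nonNeg K) (nonNegative⁻¹ 1)) (C₀-nonNeg (M ℕ.+ M) M)
    (sym (trans (C₀-absorption (M ℕ.+ M) K) (cong (_· x) (begin-equality
      ℕtoℚ (M ℕ.+ M) - ℕtoℚ K                    ≡⟨ cong (_- ℕtoℚ K) (ℕtoℚ-+ M M) ⟩
      ℕtoℚ M + ℕtoℚ M - ℕtoℚ K                   ≡⟨ cong (λ a → a + a - ℕtoℚ K) (ℕtoℚ-suc K) ⟩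
      (1 + ℕtoℚ K) + (1 + ℕtoℚ K) - ℕtoℚ K       ≡⟨ regroup (ℕtoℚ K) ⟩
      ℕtoℚ K + 1 + 1                             ∎))))
    where
    regroup : ∀ k → (1 + k) + (1 + k) - k ≡ k + 1 + 1
    regroup = solve-∀ ℚ-ring

C₀≤4·[C₁-C₂] : ∀ m → 1 ≤ℕ m → C 0 (2 * m) m ≤ 4 · (C 1 (2 * m) m - C 2 (2 * m) m)
C₀≤4·[C₁-C₂] (suc M) _ =
  subst (λ k → C 0 (suc k) (suc M) ≤ 4 · (C 1 (suc k) (suc M) - C 2 (suc k) (suc M))) (sym M+[1+M]≡1+[M+M])
    (subst (λ t → C 0 (suc (suc (M ℕ.+ M))) (suc M) ≤ 4 · t)
      (C-suc-size 1 (suc (suc (M ℕ.+ M))) (suc M)) (central-binomial-≤ M))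
  where
  M+[1+M]≡1+[M+M] : M ℕ.+ suc (M ℕ.+ 0) ≡ suc (M ℕ.+ M)
  M+[1+M]≡1+[M+M] = trans (ℕ.+-suc M (M ℕ.+ 0)) (cong (λ t → suc (M ℕ.+ t)) (ℕ.+-identityʳ M))

-- Moments of subset sums

powerSum : ∀ {n} → ℕ → (Fin n → ℚ) → ℚ
powerSum k u = sumFin (λ i → u i ^ k)

-- G a c₀ … c₄ s₁ … s₄ is a closed form for ∑_{|S| = m} (a + u(S))^k in terms of c_j = C j n m
-- and the power sums s_j of u. Splitting off the first coordinate b of u, the subsets
-- containing it give the same sum at a + b over (n, m) and the others the sum at a over
-- (n, m + 1); G-step says that the closed form obeys this recursion.
module ShiftedMoment
  (k : ℕ) (G : (a c₀ c₁ c₂ c₃ c₄ s₁ s₂ s₃ s₄ : ℚ) → ℚ)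
  (G-size-zero : ∀ a s₁ s₂ s₃ s₄ → (a + 0ℚ) ^ k + 0ℚ ≡ G a 1 0 0 0 0 s₁ s₂ s₃ s₄)
  (G-empty : ∀ a c₁ c₂ c₃ c₄ → 0ℚ ≡ G a 0 c₁ c₂ c₃ c₄ 0ℚ 0ℚ 0ℚ 0ℚ)
  (G-step : ∀ a b c₀ c₀′ c₁ c₂ c₃ c₄ s₁ s₂ s₃ s₄ →
    G (a + b) c₀ c₁ c₂ c₃ c₄ s₁ s₂ s₃ s₄ + G a c₀′ (c₀ - c₁) (c₁ - c₂) (c₂ - c₃) (c₃ - c₄) s₁ s₂ s₃ s₄
      ≡ G a (c₀ + c₀′) c₀ c₁ c₂ c₃ (b + s₁) (b ^ 2 + s₂) (b ^ 3 + s₃) (b ^ 4 + s₄))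
  where

  shifted-moment : ∀ n m (u : Fin n → ℚ) a →
    sumList (subsetsOfSize n m) (λ S → (a + mass u S) ^ k)
      ≡ G a (C 0 n m) (C 1 n m) (C 2 n m) (C 3 n m) (C 4 n m)
            (powerSum 1 u) (powerSum 2 u) (powerSum 3 u) (powerSum 4 u)
  shifted-moment n zero u a = begin
    sumList (subsetsOfSize n 0) (λ S → (a + mass u S) ^ k)
      ≡⟨ sumList-subsetsOfSize-zero n u (λ w → (a + w) ^ k) ⟩
    (a + 0ℚ) ^ k + 0ℚ
      ≡⟨ G-size-zero a (s 1) (s 2) (s 3) (s 4) ⟩
    G a 1 0 0 0 0 (s 1) (s 2) (s 3) (s 4)
      ≡⟨ cong (λ c₀ → G a c₀ 0 0 0 0 (s 1) (s 2) (s 3) (s 4)) (sym (C-zero-size n)) ⟩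
    G a (C 0 n 0) 0 0 0 0 (s 1) (s 2) (s 3) (s 4)             ∎
    where
    open ≡-Reasoning
    s : ℕ → ℚ
    s j = powerSum j u
  shifted-moment zero    (suc m) u a =
    G-empty a (C 1 0 (suc m)) (C 2 0 (suc m)) (C 3 0 (suc m)) (C 4 0 (suc m))
  shifted-moment (suc n) (suc m) u a = begin
    sumList (subsetsOfSize (suc n) (suc m)) (λ S → (a + mass u S) ^ k)
      ≡⟨ sumList-subsetsOfSize-suc n m (λ S → (a + mass u S) ^ k) ⟩
    sumList (subsetsOfSize n m) (λ S → (a + mass u (inside ∷ S)) ^ k)
      + sumList (subsetsOfSize n (suc m)) (λ S → (a + mass u (outside ∷ S)) ^ k)
      ≡⟨ cong₂ _+_
           (sumList-cong (subsetsOfSize n m) (λ S → cong (_^ k) (shift S)))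
           (sumList-cong (subsetsOfSize n (suc m)) (λ S → cong (λ w → (a + w) ^ k) (mass-outside u S))) ⟩
    sumList (subsetsOfSize n m) (λ S → ((a + b) + mass t S) ^ k)
      + sumList (subsetsOfSize n (suc m)) (λ S → (a + mass t S) ^ k)
      ≡⟨ cong₂ _+_ (shifted-moment n m t (a + b)) without-first ⟩
    G (a + b) (c 0) (c 1) (c 2) (c 3) (c 4) s₁ s₂ s₃ s₄
      + G a (C 0 n (suc m)) (c 0 - c 1) (c 1 - c 2) (c 2 - c 3) (c 3 - c 4) s₁ s₂ s₃ s₄
      ≡⟨ G-step a b (c 0) (C 0 n (suc m)) (c 1) (c 2) (c 3) (c 4) s₁ s₂ s₃ s₄ ⟩
    G a (c 0 + C 0 n (suc m)) (c 0) (c 1) (c 2) (c 3) (b + s₁) (b ^ 2 + s₂) (b ^ 3 + s₃) (b ^ 4 + s₄) ∎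
    where
    open ≡-Reasoning
    b = u zero
    t = tail u
    c : ℕ → ℚ
    c j = C j n m
    s₁ = powerSum 1 t
    s₂ = powerSum 2 t
    s₃ = powerSum 3 t
    s₄ = powerSum 4 t
    shift : ∀ S → a + mass u (inside ∷ S) ≡ (a + b) + mass t S
    shift S = trans (cong (a +_) (mass-inside u S)) (sym (+-assoc a b (mass t S)))
    without-first : sumList (subsetsOfSize n (suc m)) (λ S → (a + mass t S) ^ k)
      ≡ G a (C 0 n (suc m)) (c 0 - c 1) (c 1 - c 2) (c 2 - c 3) (c 3 - c 4) s₁ s₂ s₃ s₄
    without-first = begin
      sumList (subsetsOfSize n (suc m)) (λ S → (a + mass t S) ^ k)
        ≡⟨ shifted-moment n (suc m) t a ⟩
      G a (C 0 n (suc m)) (C 1 n (suc m)) (C 2 n (suc m)) (C 3 n (suc m)) (C 4 n (suc m)) s₁ s₂ s₃ s₄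
        ≡⟨ cong₂ (λ x y → G a (C 0 n (suc m)) x y (C 3 n (suc m)) (C 4 n (suc m)) s₁ s₂ s₃ s₄)
                 (C-suc-size 0 n m) (C-suc-size 1 n m) ⟩
      G a (C 0 n (suc m)) (c 0 - c 1) (c 1 - c 2) (C 3 n (suc m)) (C 4 n (suc m)) s₁ s₂ s₃ s₄
        ≡⟨ cong₂ (λ x y → G a (C 0 n (suc m)) (c 0 - c 1) (c 1 - c 2) x y s₁ s₂ s₃ s₄)
                 (C-suc-size 2 n m) (C-suc-size 3 n m) ⟩
      G a (C 0 n (suc m)) (c 0 - c 1) (c 1 - c 2) (c 2 - c 3) (c 3 - c 4) s₁ s₂ s₃ s₄ ∎

-- Expanding (a + u(S))^k, the coefficient of c_r collects the index tuples with exactly r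
-- distinct entries, each of which lies in C r n m of the subsets. INLINE lets solve-∀ see
-- the polynomials.
moment₂ : (a c₀ c₁ c₂ s₁ s₂ : ℚ) → ℚ
moment₂ a c₀ c₁ c₂ s₁ s₂ = a ^ 2 · c₀ + 2 · a · (c₁ · s₁) + (c₁ · s₂ + c₂ · (s₁ ^ 2 - s₂))
{-# INLINE moment₂ #-}

moment₂-size-zero : ∀ a s₁ s₂ → (a + 0ℚ) ^ 2 + 0ℚ ≡ moment₂ a 1 0 0 s₁ s₂
moment₂-size-zero = solve-∀ ℚ-ring

moment₂-empty : ∀ a c₁ c₂ → 0ℚ ≡ moment₂ a 0 c₁ c₂ 0ℚ 0ℚ
moment₂-empty = solve-∀ ℚ-ring

moment₂-step : ∀ a b c₀ c₀′ c₁ c₂ s₁ s₂ →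
  moment₂ (a + b) c₀ c₁ c₂ s₁ s₂ + moment₂ a c₀′ (c₀ - c₁) (c₁ - c₂) s₁ s₂
    ≡ moment₂ a (c₀ + c₀′) c₀ c₁ (b + s₁) (b ^ 2 + s₂)
moment₂-step = solve-∀ ℚ-ring

open ShiftedMoment 2 (λ a c₀ c₁ c₂ _ _ s₁ s₂ _ _ → moment₂ a c₀ c₁ c₂ s₁ s₂)
  (λ a s₁ s₂ _ _ → moment₂-size-zero a s₁ s₂) (λ a c₁ c₂ _ _ → moment₂-empty a c₁ c₂)
  (λ a b c₀ c₀′ c₁ c₂ _ _ s₁ s₂ _ _ → moment₂-step a b c₀ c₀′ c₁ c₂ s₁ s₂)
  renaming (shifted-moment to shifted-moment₂)

moment₄ : (a c₀ c₁ c₂ c₃ c₄ s₁ s₂ s₃ s₄ : ℚ) → ℚ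
moment₄ a c₀ c₁ c₂ c₃ c₄ s₁ s₂ s₃ s₄ =
  a ^ 4 · c₀ + 4 · a ^ 3 · (c₁ · s₁) + 6 · a ^ 2 · (c₁ · s₂ + c₂ · (s₁ ^ 2 - s₂))
  + 4 · a · (c₁ · s₃ + 3 · c₂ · (s₁ · s₂ - s₃) + c₃ · (s₁ ^ 3 - 3 · s₁ · s₂ + 2 · s₃))
  + (c₁ · s₄ + c₂ · (4 · s₁ · s₃ + 3 · s₂ ^ 2 - 7 · s₄)
     + 6 · c₃ · (s₁ ^ 2 · s₂ - 2 · s₁ · s₃ - s₂ ^ 2 + 2 · s₄)
     + c₄ · (s₁ ^ 4 - 6 · s₁ ^ 2 · s₂ + 3 · s₂ ^ 2 + 8 · s₁ · s₃ - 6 · s₄))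
{-# INLINE moment₄ #-}

moment₄-size-zero : ∀ a s₁ s₂ s₃ s₄ → (a + 0ℚ) ^ 4 + 0ℚ ≡ moment₄ a 1 0 0 0 0 s₁ s₂ s₃ s₄
moment₄-size-zero = solve-∀ ℚ-ring

moment₄-empty : ∀ a c₁ c₂ c₃ c₄ → 0ℚ ≡ moment₄ a 0 c₁ c₂ c₃ c₄ 0ℚ 0ℚ 0ℚ 0ℚ
moment₄-empty = solve-∀ ℚ-ring

moment₄-step : ∀ a b c₀ c₀′ c₁ c₂ c₃ c₄ s₁ s₂ s₃ s₄ →
  moment₄ (a + b) c₀ c₁ c₂ c₃ c₄ s₁ s₂ s₃ s₄
    + moment₄ a c₀′ (c₀ - c₁) (c₁ - c₂) (c₂ - c₃) (c₃ - c₄) s₁ s₂ s₃ s₄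
    ≡ moment₄ a (c₀ + c₀′) c₀ c₁ c₂ c₃ (b + s₁) (b ^ 2 + s₂) (b ^ 3 + s₃) (b ^ 4 + s₄)
moment₄-step = solve-∀ ℚ-ring

open ShiftedMoment 4 moment₄ moment₄-size-zero moment₄-empty moment₄-step
  renaming (shifted-moment to shifted-moment₄)

moment-as-shifted : ∀ k n m (u : Fin n → ℚ) →
  sumList (subsetsOfSize n m) (λ S → mass u S ^ k) ≡ sumList (subsetsOfSize n m) (λ S → (0ℚ + mass u S) ^ k)
moment-as-shifted k n m u =
  sumList-cong (subsetsOfSize n m) (λ S → cong (_^ k) (sym (+-identityˡ (mass u S))))

second-moment : ∀ n m (u : Fin n → ℚ) → powerSum 1 u ≡ 0ℚ →
  sumList (subsetsOfSize n m) (λ S → mass u S ^ 2) ≡ (C 1 n m - C 2 n m) · powerSum 2 u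
second-moment n m u centred = begin
  sumList (subsetsOfSize n m) (λ S → mass u S ^ 2)   ≡⟨ moment-as-shifted 2 n m u ⟩
  _                                                   ≡⟨ shifted-moment₂ n m u 0ℚ ⟩
  moment₂ 0ℚ (C 0 n m) (C 1 n m) (C 2 n m) (powerSum 1 u) (powerSum 2 u)
    ≡⟨ cong (λ s₁ → moment₂ 0ℚ (C 0 n m) (C 1 n m) (C 2 n m) s₁ (powerSum 2 u)) centred ⟩
  moment₂ 0ℚ (C 0 n m) (C 1 n m) (C 2 n m) 0ℚ (powerSum 2 u)
    ≡⟨ at-centre (C 0 n m) (C 1 n m) (C 2 n m) (powerSum 2 u) ⟩
  (C 1 n m - C 2 n m) · powerSum 2 u                 ∎
  where
  open ≡-Reasoning
  at-centre : ∀ c₀ c₁ c₂ s₂ → moment₂ 0ℚ c₀ c₁ c₂ 0ℚ s₂ ≡ (c₁ - c₂) · s₂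
  at-centre = solve-∀ ℚ-ring

powerSum₄≤powerSum₂² : ∀ {n} (u : Fin n → ℚ) → powerSum 4 u ≤ powerSum 2 u ^ 2
powerSum₄≤powerSum₂² u = subst (_≤ powerSum 2 u ^ 2) (sumFin-cong (λ i → square-square (u i)))
  (sumFin-squares-≤-square (λ i → u i ^ 2) (λ i → square-nonNeg (u i)))

powerSum₄-nonNeg : ∀ {n} (u : Fin n → ℚ) → 0ℚ ≤ powerSum 4 u
powerSum₄-nonNeg u = sumFin-nonNeg (λ i → subst (0ℚ ≤_) (square-square (u i)) (square-nonNeg (u i ^ 2)))

fourth-moment-≤ : ∀ n m (u : Fin n → ℚ) → powerSum 1 u ≡ 0ℚ →
  (∀ j → 0ℚ ≤ C (suc j) n m) → (∀ j → C (suc j) n m ≤ C 0 n m) →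
  sumList (subsetsOfSize n m) (λ S → mass u S ^ 4) ≤ 13 · C 0 n m · powerSum 2 u ^ 2
fourth-moment-≤ n m u centred 0≤C C≤C₀ = begin
  sumList (subsetsOfSize n m) (λ S → mass u S ^ 4)   ≡⟨ moment-as-shifted 4 n m u ⟩
  _                                                   ≡⟨ shifted-moment₄ n m u 0ℚ ⟩
  moment₄ 0ℚ Z (c 1) (c 2) (c 3) (c 4) (powerSum 1 u) s₂ s₃ s₄
    ≡⟨ cong (λ s₁ → moment₄ 0ℚ Z (c 1) (c 2) (c 3) (c 4) s₁ s₂ s₃ s₄) centred ⟩
  moment₄ 0ℚ Z (c 1) (c 2) (c 3) (c 4) 0ℚ s₂ s₃ s₄
    ≡⟨ at-centre Z (c 1) (c 2) (c 3) (c 4) s₂ s₃ s₄ ⟩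
  c 1 · s₄ + c 2 · (3 · s₂ ^ 2 - 7 · s₄) + 6 · (c 3 · (2 · s₄ - s₂ ^ 2)) + c 4 · (3 · s₂ ^ 2 - 6 · s₄)
    ≤⟨ +-mono-≤ (+-mono-≤ (+-mono-≤ (bounded 0 0≤s₂² s₄≤s₂²)
                                    (bounded 1 0≤3s₂² (p-q≤p (·-nonNeg (nonNegative⁻¹ 7) 0≤s₄))))
                          (·-monoˡ-≤ (nonNegative⁻¹ 6) (bounded 2 0≤s₂² twice-s₄-≤)))
                (bounded 3 0≤3s₂² (p-q≤p (·-nonNeg (nonNegative⁻¹ 6) 0≤s₄))) ⟩
  Z · s₂ ^ 2 + Z · (3 · s₂ ^ 2) + 6 · (Z · s₂ ^ 2) + Z · (3 · s₂ ^ 2)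
    ≡⟨ collect Z s₂ ⟩
  13 · Z · s₂ ^ 2                                     ∎
  where
  open ≤-Reasoning
  Z = C 0 n m
  c : ℕ → ℚ
  c j = C j n m
  s₂ = powerSum 2 u
  s₃ = powerSum 3 u
  s₄ = powerSum 4 u
  0≤s₄ = powerSum₄-nonNeg u
  s₄≤s₂² = powerSum₄≤powerSum₂² u
  0≤s₂² = square-nonNeg s₂
  0≤3s₂² = ·-nonNeg (nonNegative⁻¹ 3) 0≤s₂²
  bounded : ∀ j {x y} → 0ℚ ≤ y → x ≤ y → c (suc j) · x ≤ Z · y
  bounded j 0≤y x≤y = ≤-trans (·-monoˡ-≤ (0≤C j) x≤y) (·-monoʳ-≤ 0≤y (C≤C₀ j))
  twice-s₄-≤ : 2 · s₄ - s₂ ^ 2 ≤ s₂ ^ 2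
  twice-s₄-≤ = subst (2 · s₄ - s₂ ^ 2 ≤_) (halve s₂)
    (+-monoˡ-≤ (- s₂ ^ 2) (·-monoˡ-≤ (nonNegative⁻¹ 2) s₄≤s₂²))
    where
    halve : ∀ s₂ → 2 · s₂ ^ 2 - s₂ ^ 2 ≡ s₂ ^ 2
    halve = solve-∀ ℚ-ring
  at-centre : ∀ c₀ c₁ c₂ c₃ c₄ s₂ s₃ s₄ → moment₄ 0ℚ c₀ c₁ c₂ c₃ c₄ 0ℚ s₂ s₃ s₄
    ≡ c₁ · s₄ + c₂ · (3 · s₂ ^ 2 - 7 · s₄) + 6 · (c₃ · (2 · s₄ - s₂ ^ 2)) + c₄ · (3 · s₂ ^ 2 - 6 · s₄)
  at-centre = solve-∀ ℚ-ring
  collect : ∀ Z s₂ → Z · s₂ ^ 2 + Z · (3 · s₂ ^ 2) + 6 · (Z · s₂ ^ 2) + Z · (3 · s₂ ^ 2) ≡ 13 · Z · s₂ ^ 2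
  collect = solve-∀ ℚ-ring

-- Doubly centred matrices

module DoublyCentred {n : ℕ} (m : ℕ) (D : Fin n → Fin n → ℚ)
  (rows-centred : ∀ i → powerSum 1 (D i) ≡ 0ℚ) (columns-centred : ∀ j → sumFin (λ i → D i j) ≡ 0ℚ) where

  L = subsetsOfSize n m
  Z = C 0 n m
  K = C 1 n m - C 2 n m

  column-mass : Subset n → Fin n → ℚ
  column-mass S₂ i = mass (D i) S₂

  Y : Subset n → Subset n → ℚ
  Y S₁ S₂ = mass (column-mass S₂) S₁

  Φ : ℚ
  Φ = sumFin (λ i → powerSum 2 (D i))

  column-mass-centred : ∀ S₂ → powerSum 1 (column-mass S₂) ≡ 0ℚ
  column-mass-centred S₂ = begin
    sumFin (λ i → sumFin (λ j → 𝟙 S₂ j · D i j))  ≡⟨ sumFin-comm (λ i j → 𝟙 S₂ j · D i j) ⟩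
    sumFin (λ j → sumFin (λ i → 𝟙 S₂ j · D i j))
      ≡⟨ sumFin-cong (λ j → ·-distribˡ-sumFin (𝟙 S₂ j) (λ i → D i j)) ⟩
    sumFin (λ j → 𝟙 S₂ j · sumFin (λ i → D i j))
      ≡⟨ sumFin-cong (λ j → cong (𝟙 S₂ j ·_) (columns-centred j)) ⟩
    sumFin (λ j → 𝟙 S₂ j · 0ℚ)                    ≡⟨ sumFin-cong (λ j → *-zeroʳ (𝟙 S₂ j)) ⟩
    sumFin {n} (λ _ → 0ℚ)                         ≡⟨ sumFin-zero n ⟩
    0ℚ                                            ∎
    where open ≡-Reasoning

  sumList-pairs : ∀ (h : ℚ → ℚ) →
    sumList (pairs n m) (λ (S₁ , S₂) → h (Y S₁ S₂)) ≡ sumList L (λ S₂ → sumList L (λ S₁ → h (Y S₁ S₂)))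
  sumList-pairs h = trans (sumList-cartesianProduct L L (λ (S₁ , S₂) → h (Y S₁ S₂)))
                          (sumList-comm L L (λ S₁ S₂ → h (Y S₁ S₂)))

  pairs-second-moment : sumList (pairs n m) (λ (S₁ , S₂) → Y S₁ S₂ ^ 2) ≡ K · (K · Φ)
  pairs-second-moment = begin
    sumList (pairs n m) (λ (S₁ , S₂) → Y S₁ S₂ ^ 2)
      ≡⟨ sumList-pairs (_^ 2) ⟩
    sumList L (λ S₂ → sumList L (λ S₁ → Y S₁ S₂ ^ 2))
      ≡⟨ sumList-cong L (λ S₂ → second-moment n m (column-mass S₂) (column-mass-centred S₂)) ⟩
    sumList L (λ S₂ → K · powerSum 2 (column-mass S₂))
      ≡⟨ ·-distribˡ-sumList L K _ ⟩
    K · sumList L (λ S₂ → sumFin (λ i → mass (D i) S₂ ^ 2))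
      ≡⟨ cong (K ·_) (sumList-sumFin L (λ S₂ i → mass (D i) S₂ ^ 2)) ⟩
    K · sumFin (λ i → sumList L (λ S₂ → mass (D i) S₂ ^ 2))
      ≡⟨ cong (K ·_) (sumFin-cong (λ i → second-moment n m (D i) (rows-centred i))) ⟩
    K · sumFin (λ i → K · powerSum 2 (D i))
      ≡⟨ cong (K ·_) (·-distribˡ-sumFin K (λ i → powerSum 2 (D i))) ⟩
    K · (K · Φ) ∎
    where open ≡-Reasoning

  row-mass² : Fin n → Subset n → ℚ
  row-mass² i S = mass (D i) S ^ 2

  row-norm² : Fin n → ℚ
  row-norm² i = powerSum 2 (D i)

  module _ (0≤C : ∀ j → 0ℚ ≤ C (suc j) n m) (C≤Z : ∀ j → C (suc j) n m ≤ Z) where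

    0≤13Z : 0ℚ ≤ 13 · Z
    0≤13Z = ·-nonNeg (nonNegative⁻¹ 13) (C₀-nonNeg n m)

    fourth-moment-products-≤ : ∀ i i′ →
      sumList L (λ S → row-mass² i S · row-mass² i′ S) ≤ 13 · Z · (row-norm² i · row-norm² i′)
    fourth-moment-products-≤ i i′ =
      sumList-·-≤ L {f = row-mass² i} {g = row-mass² i′} 0≤13Z
        (sumFin-nonNeg (λ j → square-nonNeg (D i j))) (sumFin-nonNeg (λ j → square-nonNeg (D i′ j)))
        (fourth i) (fourth i′)
      where
      fourth : ∀ i → sumList L (λ S → row-mass² i S ^ 2) ≤ 13 · Z · row-norm² i ^ 2
      fourth i = subst (_≤ 13 · Z · row-norm² i ^ 2)
        (sumList-cong L (λ S → sym (square-square (mass (D i) S))))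
        (fourth-moment-≤ n m (D i) (rows-centred i) 0≤C C≤Z)

    pairs-fourth-moment-≤ : sumList (pairs n m) (λ (S₁ , S₂) → Y S₁ S₂ ^ 4) ≤ 13 · Z · (13 · Z · Φ ^ 2)
    pairs-fourth-moment-≤ = begin
      sumList (pairs n m) (λ (S₁ , S₂) → Y S₁ S₂ ^ 4)
        ≡⟨ sumList-pairs (_^ 4) ⟩
      sumList L (λ S₂ → sumList L (λ S₁ → Y S₁ S₂ ^ 4))
        ≤⟨ sumList-mono-≤ L (λ S → fourth-moment-≤ n m (column-mass S) (column-mass-centred S) 0≤C C≤Z) ⟩
      sumList L (λ S → 13 · Z · sumFin (λ i → row-mass² i S) ^ 2)
        ≡⟨ ·-distribˡ-sumList L (13 · Z) (λ S → sumFin (λ i → row-mass² i S) ^ 2) ⟩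
      13 · Z · sumList L (λ S → sumFin (λ i → row-mass² i S) ^ 2)
        ≡⟨ cong (13 · Z ·_) expand ⟩
      13 · Z · sumFin (λ i → sumFin (λ i′ → sumList L (λ S → row-mass² i S · row-mass² i′ S)))
        ≤⟨ ·-monoˡ-≤ 0≤13Z (sumFin-mono-≤ (λ i → sumFin-mono-≤ (fourth-moment-products-≤ i))) ⟩
      13 · Z · sumFin (λ i → sumFin (λ i′ → 13 · Z · (row-norm² i · row-norm² i′)))
        ≡⟨ cong (13 · Z ·_) collapse ⟩
      13 · Z · (13 · Z · Φ ^ 2) ∎
      where
      open ≤-Reasoning
      expand : sumList L (λ S → sumFin (λ i → row-mass² i S) ^ 2)
             ≡ sumFin (λ i → sumFin (λ i′ → sumList L (λ S → row-mass² i S · row-mass² i′ S)))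
      expand = begin-equality
        sumList L (λ S → sumFin (λ i → row-mass² i S) ^ 2)
          ≡⟨ sumList-cong L (λ S → sumFin-·-sumFin (λ i → row-mass² i S) (λ i → row-mass² i S)) ⟩
        sumList L (λ S → sumFin (λ i → sumFin (λ i′ → row-mass² i S · row-mass² i′ S)))
          ≡⟨ sumList-sumFin L (λ S i → sumFin (λ i′ → row-mass² i S · row-mass² i′ S)) ⟩
        sumFin (λ i → sumList L (λ S → sumFin (λ i′ → row-mass² i S · row-mass² i′ S)))
          ≡⟨ sumFin-cong (λ i → sumList-sumFin L (λ S i′ → row-mass² i S · row-mass² i′ S)) ⟩
        sumFin (λ i → sumFin (λ i′ → sumList L (λ S → row-mass² i S · row-mass² i′ S))) ∎
      collapse : sumFin (λ i → sumFin (λ i′ → 13 · Z · (row-norm² i · row-norm² i′))) ≡ 13 · Z · Φ ^ 2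
      collapse = begin-equality
        sumFin (λ i → sumFin (λ i′ → 13 · Z · (row-norm² i · row-norm² i′)))
          ≡⟨ sumFin-cong (λ i → ·-distribˡ-sumFin (13 · Z) (λ i′ → row-norm² i · row-norm² i′)) ⟩
        sumFin (λ i → 13 · Z · sumFin (λ i′ → row-norm² i · row-norm² i′))
          ≡⟨ ·-distribˡ-sumFin (13 · Z) (λ i → sumFin (λ i′ → row-norm² i · row-norm² i′)) ⟩
        13 · Z · sumFin (λ i → sumFin (λ i′ → row-norm² i · row-norm² i′))
          ≡⟨ cong (13 · Z ·_) (sym (sumFin-·-sumFin row-norm² row-norm²)) ⟩
        13 · Z · Φ ^ 2 ∎

-- Distributions on [k] × [k]

module Discrepancy {n : ℕ} (p : Fin n → Fin n → ℚ) (dist : IsDist2 n p) where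
  open IsDist2 dist

  p₁ = marg₁ p
  p₂ = marg₂ p

  D : Fin n → Fin n → ℚ
  D i j = p i j - p₁ i · p₂ j

  rows-centred : ∀ i → powerSum 1 (D i) ≡ 0ℚ
  rows-centred i = begin
    sumFin (λ j → p i j - p₁ i · p₂ j)          ≡⟨ sumFin-distrib-- (p i) (λ j → p₁ i · p₂ j) ⟩
    p₁ i - sumFin (λ j → p₁ i · p₂ j)           ≡⟨ cong (λ x → p₁ i - x) (·-distribˡ-sumFin (p₁ i) p₂) ⟩
    p₁ i - p₁ i · sumFin p₂
      ≡⟨ cong (λ x → p₁ i - p₁ i · x) (trans (sym (sumFin-comm p)) total) ⟩
    p₁ i - p₁ i · 1ℚ                            ≡⟨ cancel (p₁ i) ⟩
    0ℚ                                          ∎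
    where
    open ≡-Reasoning
    cancel : ∀ x → x - x · 1ℚ ≡ 0ℚ
    cancel = solve-∀ ℚ-ring

  columns-centred : ∀ j → sumFin (λ i → D i j) ≡ 0ℚ
  columns-centred j = begin
    sumFin (λ i → p i j - p₁ i · p₂ j)          ≡⟨ sumFin-distrib-- (λ i → p i j) (λ i → p₁ i · p₂ j) ⟩
    p₂ j - sumFin (λ i → p₁ i · p₂ j)           ≡⟨ cong (λ x → p₂ j - x) (·-distribʳ-sumFin (p₂ j) p₁) ⟩
    p₂ j - sumFin p₁ · p₂ j                     ≡⟨ cong (λ x → p₂ j - x · p₂ j) total ⟩
    p₂ j - 1ℚ · p₂ j                            ≡⟨ cancel (p₂ j) ⟩
    0ℚ                                          ∎
    where
    open ≡-Reasoning
    cancel : ∀ x → x - 1ℚ · x ≡ 0ℚ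
    cancel = solve-∀ ℚ-ring

  discrepancy-mass : ∀ S₁ S₂ → mass₂ p S₁ S₂ - mass p₁ S₁ · mass p₂ S₂ ≡ mass (λ i → mass (D i) S₂) S₁
  discrepancy-mass S₁ S₂ = begin
    mass₂ p S₁ S₂ - mass p₁ S₁ · mass p₂ S₂
      ≡⟨ cong (λ x → mass₂ p S₁ S₂ - x) (sumFin-·-sumFin (λ i → 𝟙 S₁ i · p₁ i) (λ j → 𝟙 S₂ j · p₂ j)) ⟩
    mass₂ p S₁ S₂ - sumFin (λ i → sumFin (λ j → (𝟙 S₁ i · p₁ i) · (𝟙 S₂ j · p₂ j)))
      ≡⟨ sym (sumFin-distrib-- (λ i → sumFin (λ j → 𝟙 S₁ i · 𝟙 S₂ j · p i j))
                               (λ i → sumFin (λ j → (𝟙 S₁ i · p₁ i) · (𝟙 S₂ j · p₂ j)))) ⟩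
    sumFin (λ i → sumFin (λ j → 𝟙 S₁ i · 𝟙 S₂ j · p i j) - sumFin (λ j → (𝟙 S₁ i · p₁ i) · (𝟙 S₂ j · p₂ j)))
      ≡⟨ sumFin-cong (λ i → sym (sumFin-distrib-- (λ j → 𝟙 S₁ i · 𝟙 S₂ j · p i j)
                                                  (λ j → (𝟙 S₁ i · p₁ i) · (𝟙 S₂ j · p₂ j)))) ⟩
    sumFin (λ i → sumFin (λ j → 𝟙 S₁ i · 𝟙 S₂ j · p i j - (𝟙 S₁ i · p₁ i) · (𝟙 S₂ j · p₂ j)))
      ≡⟨ sumFin-cong (λ i → sumFin-cong (λ j → factor (𝟙 S₁ i) (𝟙 S₂ j) (p i j) (p₁ i) (p₂ j))) ⟩
    sumFin (λ i → sumFin (λ j → 𝟙 S₁ i · (𝟙 S₂ j · D i j)))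
      ≡⟨ sumFin-cong (λ i → ·-distribˡ-sumFin (𝟙 S₁ i) (λ j → 𝟙 S₂ j · D i j)) ⟩
    mass (λ i → mass (D i) S₂) S₁ ∎
    where
    open ≡-Reasoning
    factor : ∀ a b x y z → a · b · x - (a · y) · (b · z) ≡ a · (b · (x - y · z))
    factor = solve-∀ ℚ-ring

-- θ = τ★ · Φ is the best parameter in paley-zygmund for these moment bounds; it gives
-- ρ★ = (3/64)² / 169.
¼ ρ★ τ★ ε★ : ℚ
¼  = ℤ.+ 1 / 4
ρ★ = ℤ.+ 9 / 692224
τ★ = ℤ.+ 10816 / 3
ε★ = ℤ.+ 1 / 64

probability-from-moments : ∀ {Z K Φ N G S₂ S₄} → 0ℚ < Φ → 0ℚ ≤ Z → Z ≤ 4 · K → N ≡ Z ^ 2 →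
  S₂ ≡ K · (K · Φ) → S₄ ≤ 13 · Z · (13 · Z · Φ ^ 2) →
  2 · (τ★ · Φ) · S₂ ≤ 2 · (τ★ · Φ) · (ε★ · Φ) · N + ((τ★ · Φ) ^ 2 · G + S₄) →
  ρ★ · N ≤ G
probability-from-moments {Z} {K} {Φ} {N} {G} {S₂} {S₄} 0<Φ 0≤Z Z≤4K refl refl S₄≤ pz =
  ·-cancelˡ-≤ (·-pos 0<τΦ 0<τΦ) (+-cancelʳ-≤ R (begin
    (τ★ · Φ) ^ 2 · (ρ★ · Z ^ 2) + R                          ≡⟨ collect τ★ ρ★ ε★ Z Φ ⟩
    (τ★ · τ★ · ρ★ + 2 · τ★ · ε★ + 169) · (Φ ^ 2 · Z ^ 2)    ≡⟨ cong (_· (Φ ^ 2 · Z ^ 2)) constants ⟩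
    2 · τ★ · (¼ · ¼) · (Φ ^ 2 · Z ^ 2)                       ≡⟨ spread τ★ ¼ Z Φ ⟩
    2 · (τ★ · Φ) · ((¼ · Z) ^ 2 · Φ)
      ≤⟨ ·-monoˡ-≤ 0≤2τΦ (·-monoʳ-≤ 0≤Φ (·-mono-≤ 0≤Z/4 0≤Z/4 Z/4≤K Z/4≤K)) ⟩
    2 · (τ★ · Φ) · (K ^ 2 · Φ)                               ≡⟨ cong (2 · (τ★ · Φ) ·_) (*-assoc K K Φ) ⟩
    2 · (τ★ · Φ) · (K · (K · Φ))                             ≤⟨ pz ⟩
    2 · (τ★ · Φ) · (ε★ · Φ) · Z ^ 2 + ((τ★ · Φ) ^ 2 · G + S₄)
      ≤⟨ +-monoʳ-≤ (2 · (τ★ · Φ) · (ε★ · Φ) · Z ^ 2) (+-monoʳ-≤ ((τ★ · Φ) ^ 2 · G) S₄≤) ⟩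
    2 · (τ★ · Φ) · (ε★ · Φ) · Z ^ 2 + ((τ★ · Φ) ^ 2 · G + 13 · Z · (13 · Z · Φ ^ 2))
      ≡⟨ reorder τ★ ε★ Z Φ G ⟩
    (τ★ · Φ) ^ 2 · G + R ∎))
  where
  open ≤-Reasoning
  0≤Φ = <⇒≤ 0<Φ
  0<τΦ = ·-pos (positive⁻¹ τ★) 0<Φ
  0≤2τΦ = ·-nonNeg (nonNegative⁻¹ 2) (<⇒≤ 0<τΦ)
  0≤Z/4 = ·-nonNeg (nonNegative⁻¹ ¼) 0≤Z
  Z/4≤K : ¼ · Z ≤ K
  Z/4≤K = ·-cancelˡ-≤ (positive⁻¹ 4) (subst (_≤ 4 · K) (quarter Z) Z≤4K)
    where
    quarter : ∀ Z → Z ≡ 4 · (¼ · Z)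
    quarter = solve-∀ ℚ-ring
  R = 2 · (τ★ · Φ) · (ε★ · Φ) · Z ^ 2 + 13 · Z · (13 · Z · Φ ^ 2)
  -- solve-∀ cannot cope with numerals this large, so collect is symbolic in τ ρ ε.
  constants : τ★ · τ★ · ρ★ + 2 · τ★ · ε★ + 169 ≡ 2 · τ★ · (¼ · ¼)
  constants = refl
  collect : ∀ τ ρ ε Z Φ →
    (τ · Φ) ^ 2 · (ρ · Z ^ 2) + (2 · (τ · Φ) · (ε · Φ) · Z ^ 2 + 13 · Z · (13 · Z · Φ ^ 2))
    ≡ (τ · τ · ρ + 2 · τ · ε + 169) · (Φ ^ 2 · Z ^ 2)
  collect = solve-∀ ℚ-ring
  spread : ∀ τ q Z Φ → 2 · τ · (q · q) · (Φ ^ 2 · Z ^ 2) ≡ 2 · (τ · Φ) · ((q · Z) ^ 2 · Φ)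
  spread = solve-∀ ℚ-ring
  reorder : ∀ τ ε Z Φ G → 2 · (τ · Φ) · (ε · Φ) · Z ^ 2 + ((τ · Φ) ^ 2 · G + 13 · Z · (13 · Z · Φ ^ 2))
    ≡ (τ · Φ) ^ 2 · G + (2 · (τ · Φ) · (ε · Φ) · Z ^ 2 + 13 · Z · (13 · Z · Φ ^ 2))
  reorder = solve-∀ ℚ-ring

m≤2*m : ∀ m → m ≤ℕ 2 * m
m≤2*m m = ℕ.m≤m+n m (m ℕ.+ 0)

m<2*m : ∀ {m} → 1 ≤ℕ m → suc m ≤ℕ 2 * m
m<2*m {m} 1≤m = ℕ.m<m+n m (ℕ.≤-trans 1≤m (ℕ.m≤m+n m 0))

module Corollary (m : ℕ) (1≤m : 1 ≤ℕ m) (p : Fin (2 * m) → Fin (2 * m) → ℚ) (dist : IsDist2 (2 * m) p) where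
  open Discrepancy p dist
  open DoublyCentred m D rows-centred columns-centred

  n = 2 * m
  N = ℕtoℚ n
  E? = Event? p ¼

  0<N : 0ℚ < N
  0<N = ℕtoℚ-pos (ℕ.≤-trans 1≤m (m≤2*m m))

  ℓ₁ : ℚ
  ℓ₁ = sumFin (λ i → sumFin (λ j → ∣ D i j ∣))

  ℓ₁²≤ : ℓ₁ ^ 2 ≤ N · (N · Φ)
  ℓ₁²≤ = subst (λ x → ℓ₁ ^ 2 ≤ N · (N · x)) (sumFin-cong (λ i → sumFin-cong (λ j → abs-square (D i j))))
    (cauchy-schwarz-sumFin² (λ i j → ∣ D i j ∣))

  0<Φ : 0ℚ < dTV p (marg₁ p ⊗ marg₂ p) → 0ℚ < Φ
  0<Φ 0<dTV = positive-factor 0<N (positive-factor 0<N (<-≤-trans (·-pos 0<ℓ₁ 0<ℓ₁) ℓ₁²≤))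
    where
    positive-factor : ∀ {r q} → 0ℚ < r → 0ℚ < r · q → 0ℚ < q
    positive-factor {r} {q} 0<r 0<rq =
      *-cancelˡ-<-nonNeg r {{nonNegative (<⇒≤ 0<r)}} (subst (_< r · q) (sym (*-zeroʳ r)) 0<rq)
    0<ℓ₁ : 0ℚ < ℓ₁
    0<ℓ₁ = subst (0ℚ <_) (double ℓ₁) (·-pos (positive⁻¹ 2) 0<dTV)
      where
      double : ∀ x → 2 · (½ · x) ≡ x
      double = solve-∀ ℚ-ring

  small-off-event : ∀ S₁ S₂ → ¬ Event p ¼ (S₁ , S₂) → Y S₁ S₂ ^ 2 ≤ ε★ · Φ
  small-off-event S₁ S₂ ¬E = ·-cancelˡ-≤ 0<N (·-cancelˡ-≤ 0<N (begin
    N · (N · Y S₁ S₂ ^ 2)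
      ≡⟨ cong (λ y → N · (N · y)) (sym (trans (abs-square X) (cong (_^ 2) (discrepancy-mass S₁ S₂)))) ⟩
    N · (N · ∣ X ∣ ^ 2)               ≡⟨ regroup₁ N ∣ X ∣ ⟩
    (N · ∣ X ∣) ^ 2                   ≤⟨ ·-mono-≤ 0≤N|X| 0≤N|X| (<⇒≤ N|X|<) (<⇒≤ N|X|<) ⟩
    (¼ · (½ · ℓ₁)) ^ 2               ≡⟨ regroup₂ ℓ₁ ⟩
    ε★ · ℓ₁ ^ 2                       ≤⟨ ·-monoˡ-≤ (nonNegative⁻¹ ε★) ℓ₁²≤ ⟩
    ε★ · (N · (N · Φ))                ≡⟨ regroup₃ N Φ ⟩
    N · (N · (ε★ · Φ))                ∎))
    where
    open ≤-Reasoning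
    X = mass₂ p S₁ S₂ - mass p₁ S₁ · mass p₂ S₂
    N|X|< : N · ∣ X ∣ < ¼ · (½ · ℓ₁)
    N|X|< = ≰⇒> ¬E
    0≤N|X| = ·-nonNeg (<⇒≤ 0<N) (0≤∣p∣ X)
    regroup₁ : ∀ N x → N · (N · x ^ 2) ≡ (N · x) ^ 2
    regroup₁ = solve-∀ ℚ-ring
    regroup₂ : ∀ ℓ → (¼ · (½ · ℓ)) ^ 2 ≡ ε★ · ℓ ^ 2
    regroup₂ = solve-∀ ℚ-ring
    regroup₃ : ∀ N Φ → ε★ · (N · (N · Φ)) ≡ N · (N · (ε★ · Φ))
    regroup₃ = solve-∀ ℚ-ring

  count-pairs : sumList (pairs n m) (λ _ → 1) ≡ Z ^ 2
  count-pairs = begin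
    sumList (pairs n m) (λ _ → 1)               ≡⟨ sumList-cartesianProduct L L (λ _ → 1) ⟩
    sumList L (λ _ → sumList L (λ _ → 1))
      ≡⟨ sumList-cong L (λ _ → trans (count-subsetsOfSize n m) (sym (*-identityˡ Z))) ⟩
    sumList L (λ _ → 1 · Z)                     ≡⟨ ·-distribʳ-sumList L Z (λ _ → 1) ⟩
    sumList L (λ _ → 1) · Z                     ≡⟨ cong (_· Z) (count-subsetsOfSize n m) ⟩
    Z ^ 2                                       ∎
    where open ≡-Reasoning

  pairs-fourth-moment : sumList (pairs n m) (λ (S₁ , S₂) → (Y S₁ S₂ ^ 2) ^ 2) ≤ 13 · Z · (13 · Z · Φ ^ 2)
  pairs-fourth-moment = subst (_≤ 13 · Z · (13 · Z · Φ ^ 2))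
    (sumList-cong (pairs n m) (λ (S₁ , S₂) → sym (square-square (Y S₁ S₂))))
    (pairs-fourth-moment-≤ (λ j → C-nonNeg (suc j) n m (m≤2*m m)) (λ j → C≤C₀ (suc j) n m (m<2*m 1≤m)))

  probability-bound : 0ℚ < dTV p (marg₁ p ⊗ marg₂ p) → ProbAtLeast n m E? ρ★
  probability-bound 0<dTV =
    subst₂ (λ N G → ρ★ · N ≤ G) (sym (ℕtoℚ-length (pairs n m))) (sym (ℕtoℚ-length-filter E? (pairs n m)))
      (probability-from-moments {K = K} (0<Φ 0<dTV) (C₀-nonNeg n m) (C₀≤4·[C₁-C₂] m 1≤m) count-pairs
        pairs-second-moment pairs-fourth-moment
        (paley-zygmund (pairs n m) E? (λ (S₁ , S₂) → Y S₁ S₂ ^ 2)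
          (·-nonNeg (nonNegative⁻¹ ε★) 0≤Φ) (·-nonNeg (nonNegative⁻¹ τ★) 0≤Φ)
          (λ (S₁ , S₂) → small-off-event S₁ S₂)))
    where
    0≤Φ = <⇒≤ (0<Φ 0<dTV)

corollary6p10 :
    Σ ℚ (λ c → Σ ℚ (λ ρ → (0ℚ < c) × (0ℚ < ρ) ×
      ((m : ℕ) → 1 ≤ℕ m →
        (p : Fin (2 * m) → Fin (2 * m) → ℚ) → IsDist2 (2 * m) p →
        (γ : ℚ) → 0ℚ < γ → γ ≤ dTV p (marg₁ p ⊗ marg₂ p) →
        ProbAtLeast (2 * m) m (Event? p c) ρ)))
corollary6p10 = ¼ , ρ★ , positive⁻¹ ¼ , positive⁻¹ ρ★ ,
  λ m 1≤m p dist γ 0<γ γ≤dTV → Corollary.probability-bound m 1≤m p dist (<-≤-trans 0<γ γ≤dTV)
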